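{- Up to isomorphism, $\mathcal{R}_8$ is the only misère quotient of order $8$; that is, every misère quotient $(\mathcal{Q},\mathcal{P})$ with $|\mathcal{Q}| = 8$ is isomorphic to $\mathcal{R}_8$ (and $\mathcal{R}_8$ is a misère quotient).
   Context: Impartial games: a game is the set of its options; $0=\emptyset$; $G+H$ has options $G'+H$, $G+H'$. Misère play: $G$ is a $\mathscr{P}$-position iff $G\ne0$ and every option is an $\mathscr{N}$-position. A set of games is closed if it contains $0$ and is closed under options and sums. For closed $\mathscr{A}$, $G\equiv_\mathscr{A}H$ iff $G+X$, $H+X$ have the same misère outcome for all $X\in\mathscr{A}$; the misère quotient $\mathcal{Q}(\mathscr{A})$ is the commutative monoid $\mathscr{A}/{\equiv_\mathscr{A}}$ with distinguished subset the classes of $\mathscr{P}$-positions. A bipartite monoid (commutative monoid with distinguished subset; isomorphisms preserve the subset) is a misère quotient if isomorphic to some $\mathcal{Q}(\mathscr{A})$; its order is $|\mathcal{Q}|$. $\mathcal{R}_8$ is the bipartite monoid with distinct elements $1,a,z_0,z_1,z_2,z_3,t,at$, identity $1$, multiplication $a^2=1$, $z_iz_j=z_{i\oplus j}$, $az_i=z_{i\oplus1}$ ($\oplus$ = bitwise XOR), $t\cdot a=at$, $t^2=z_0$, $tz_i=z_i$ (hence $(at)a=t$, $(at)t=z_1$, $(at)^2=z_0$, $(at)z_i=z_{i\oplus1}$), and distinguished subset $\{a,z_0\}$. -}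

module Defs where

open import Data.Bool using (Bool; true; false; not; _∧_; _xor_; T)
open import Data.Nat using (ℕ; _≡ᵇ_)
open import Data.Nat.Properties using (≡ᵇ⇒≡)
open import Data.List using (List; []; _∷_; _++_)
open import Data.List.Membership.Propositional using (_∈_)
open import Data.Product using (Σ; _×_; _,_; ∃)
open import Data.Unit using (tt)
open import Data.Sum using (_⊎_)
open import Relation.Binary.PropositionalEquality using (_≡_; refl; cong; trans; sym)
open import Function.Bundles using (_⇔_)

data Game : Set where
  mk : List Game → Game

options : Game → List Game
options (mk gs) = gs

𝟎 : Game
𝟎 = mk []

infixl 6 _+G_
_+G_ : Game → Game → Game
plusL : List Game → Game → List Game
plusR : Game → List Game → List Game
mk gs +G mk hs = mk (plusL gs (mk hs) ++ plusR (mk gs) hs)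
plusL []       H = []
plusL (g ∷ gs) H = (g +G H) ∷ plusL gs H
plusR G []       = []
plusR G (h ∷ hs) = (G +G h) ∷ plusR G hs

isP : Game → Bool
allN : List Game → Bool
isP (mk []) = false
isP (mk (g ∷ gs)) = allN (g ∷ gs)
allN [] = true
allN (g ∷ gs) = not (isP g) ∧ allN gs

record Closed (A : Game → Set) : Set where
  field
    has-𝟎     : A 𝟎
    options-closed : ∀ G G′ → A G → G′ ∈ options G → A G′
    sum-closed : ∀ G H → A G → A H → A (G +G H)

Indist : (A : Game → Set) → Game → Game → Set
Indist A G H = ∀ X → A X → isP (G +G X) ≡ isP (H +G X)

record BipartiteMonoid : Set₁ where
  infixl 7 _∙_
  field
    Carrier : Set
    _∙_     : Carrier → Carrier → Carrier
    ε       : Carrier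
    P       : Carrier → Set
    assoc   : ∀ x y z → (x ∙ y) ∙ z ≡ x ∙ (y ∙ z)
    comm    : ∀ x y → x ∙ y ≡ y ∙ x
    identityˡ : ∀ x → ε ∙ x ≡ x

record Iso (M N : BipartiteMonoid) : Set where
  private
    module M = BipartiteMonoid M
    module N = BipartiteMonoid N
  field
    to      : M.Carrier → N.Carrier
    from    : N.Carrier → M.Carrier
    from-to : ∀ x → from (to x) ≡ x
    to-from : ∀ y → to (from y) ≡ y
    hom     : ∀ x y → to (x M.∙ y) ≡ to x N.∙ to y
    hom-ε   : to M.ε ≡ N.ε
    hom-P   : ∀ x → M.P x ⇔ N.P (to x)

-- "Q(A) is (isomorphic to) M": φ is a surjection from the games of A onto M
-- whose kernel is exactly ≡_A, which turns sums into products, sends 0 to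
-- the identity, and sends exactly the P-positions into the distinguished
-- subset.  Then M ≅ A / ≡_A = Q(A) as bipartite monoids.
record Presents (A : Game → Set) (M : BipartiteMonoid) : Set where
  open BipartiteMonoid M
  field
    φ        : Σ Game A → Carrier
    surj     : ∀ m → ∃ λ g → φ g ≡ m
    kernel   : ∀ G H (g : A G) (h : A H) → (φ (G , g) ≡ φ (H , h)) ⇔ Indist A G H
    hom      : ∀ G H (g : A G) (h : A H) (gh : A (G +G H)) →
               φ (G +G H , gh) ≡ φ (G , g) ∙ φ (H , h)
    hom-𝟎    : ∀ (z : A 𝟎) → φ (𝟎 , z) ≡ ε
    hom-P    : ∀ G (g : A G) → P (φ (G , g)) ⇔ (isP G ≡ true)

IsMisereQuotient : BipartiteMonoid → Set₁
IsMisereQuotient M = Σ (Game → Set) λ A → Closed A × Presents A M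

-- The bipartite monoid R₈.  z b₁ b₀ stands for z_i with i = 2·b₁ + b₀.

data R8 : Set where
  one a t at : R8
  z : Bool → Bool → R8

infixl 7 _·_
_·_ : R8 → R8 → R8
one · y = y
x · one = x
a · a = one
a · t = at
a · at = t
a · z h l = z h (not l)
t · a = at
t · t = z false false
t · at = z false true
t · z h l = z h l
at · a = t
at · t = z false true
at · at = z false false
at · z h l = z h (not l)
z h l · a = z h (not l)
z h l · t = z h l
z h l · at = z h (not l)
z h l · z h′ l′ = z (h xor h′) (l xor l′)

R8-P : R8 → Set
R8-P x = (x ≡ a) ⊎ (x ≡ z false false)

private
  code : R8 → ℕ
  code one = 0
  code a = 1
  code t = 2
  code at = 3
  code (z false false) = 4
  code (z false true) = 5
  code (z true false) = 6
  code (z true true) = 7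

  decode : ℕ → R8
  decode 0 = one
  decode 1 = a
  decode 2 = t
  decode 3 = at
  decode 4 = z false false
  decode 5 = z false true
  decode 6 = z true false
  decode _ = z true true

  decode-code : ∀ x → decode (code x) ≡ x
  decode-code one = refl
  decode-code a = refl
  decode-code t = refl
  decode-code at = refl
  decode-code (z false false) = refl
  decode-code (z false true) = refl
  decode-code (z true false) = refl
  decode-code (z true true) = refl

  eqb : R8 → R8 → Bool
  eqb x y = code x ≡ᵇ code y

  eqb-sound : ∀ x y → T (eqb x y) → x ≡ y
  eqb-sound x y p =
    trans (sym (decode-code x))
      (trans (cong decode (≡ᵇ⇒≡ (code x) (code y) p)) (decode-code y))

  ∧-l : ∀ b c → T (b ∧ c) → T b
  ∧-l true c _ = tt

  ∧-r : ∀ b c → T (b ∧ c) → T c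
  ∧-r true c p = p

  allL : (R8 → Bool) → List R8 → Bool
  allL p [] = true
  allL p (x ∷ xs) = p x ∧ allL p xs

  allR8 : (R8 → Bool) → Bool
  allR8 p = allL p (one ∷ a ∷ t ∷ at ∷ z false false ∷ z false true ∷ z true false ∷ z true true ∷ [])

  hd : ∀ p x xs → T (allL p (x ∷ xs)) → T (p x)
  hd p x xs q = ∧-l (p x) (allL p xs) q

  tl : ∀ p x xs → T (allL p (x ∷ xs)) → T (allL p xs)
  tl p x xs q = ∧-r (p x) (allL p xs) q

  allR8-sound : ∀ p → T (allR8 p) → ∀ x → T (p x)
  allR8-sound p q one = hd p one (a ∷ t ∷ at ∷ (z false false) ∷ (z false true) ∷ (z true false) ∷ (z true true) ∷ []) q
  allR8-sound p q a = hd p a (t ∷ at ∷ (z false false) ∷ (z false true) ∷ (z true false) ∷ (z true true) ∷ []) (tl p one (a ∷ t ∷ at ∷ (z false false) ∷ (z false true) ∷ (z true false) ∷ (z true true) ∷ []) q)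
  allR8-sound p q t = hd p t (at ∷ (z false false) ∷ (z false true) ∷ (z true false) ∷ (z true true) ∷ []) (tl p a (t ∷ at ∷ (z false false) ∷ (z false true) ∷ (z true false) ∷ (z true true) ∷ []) (tl p one (a ∷ t ∷ at ∷ (z false false) ∷ (z false true) ∷ (z true false) ∷ (z true true) ∷ []) q))
  allR8-sound p q at = hd p at ((z false false) ∷ (z false true) ∷ (z true false) ∷ (z true true) ∷ []) (tl p t (at ∷ (z false false) ∷ (z false true) ∷ (z true false) ∷ (z true true) ∷ []) (tl p a (t ∷ at ∷ (z false false) ∷ (z false true) ∷ (z true false) ∷ (z true true) ∷ []) (tl p one (a ∷ t ∷ at ∷ (z false false) ∷ (z false true) ∷ (z true false) ∷ (z true true) ∷ []) q)))
  allR8-sound p q (z false false) = hd p (z false false) ((z false true) ∷ (z true false) ∷ (z true true) ∷ []) (tl p at ((z false false) ∷ (z false true) ∷ (z true false) ∷ (z true true) ∷ []) (tl p t (at ∷ (z false false) ∷ (z false true) ∷ (z true false) ∷ (z true true) ∷ []) (tl p a (t ∷ at ∷ (z false false) ∷ (z false true) ∷ (z true false) ∷ (z true true) ∷ []) (tl p one (a ∷ t ∷ at ∷ (z false false) ∷ (z false true) ∷ (z true false) ∷ (z true true) ∷ []) q))))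
  allR8-sound p q (z false true) = hd p (z false true) ((z true false) ∷ (z true true) ∷ []) (tl p (z false false) ((z false true) ∷ (z true false) ∷ (z true true) ∷ []) (tl p at ((z false false) ∷ (z false true) ∷ (z true false) ∷ (z true true) ∷ []) (tl p t (at ∷ (z false false) ∷ (z false true) ∷ (z true false) ∷ (z true true) ∷ []) (tl p a (t ∷ at ∷ (z false false) ∷ (z false true) ∷ (z true false) ∷ (z true true) ∷ []) (tl p one (a ∷ t ∷ at ∷ (z false false) ∷ (z false true) ∷ (z true false) ∷ (z true true) ∷ []) q)))))
  allR8-sound p q (z true false) = hd p (z true false) ((z true true) ∷ []) (tl p (z false true) ((z true false) ∷ (z true true) ∷ []) (tl p (z false false) ((z false true) ∷ (z true false) ∷ (z true true) ∷ []) (tl p at ((z false false) ∷ (z false true) ∷ (z true false) ∷ (z true true) ∷ []) (tl p t (at ∷ (z false false) ∷ (z false true) ∷ (z true false) ∷ (z true true) ∷ []) (tl p a (t ∷ at ∷ (z false false) ∷ (z false true) ∷ (z true false) ∷ (z true true) ∷ []) (tl p one (a ∷ t ∷ at ∷ (z false false) ∷ (z false true) ∷ (z true false) ∷ (z true true) ∷ []) q))))))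
  allR8-sound p q (z true true) = hd p (z true true) [] (tl p (z true false) ((z true true) ∷ []) (tl p (z false true) ((z true false) ∷ (z true true) ∷ []) (tl p (z false false) ((z false true) ∷ (z true false) ∷ (z true true) ∷ []) (tl p at ((z false false) ∷ (z false true) ∷ (z true false) ∷ (z true true) ∷ []) (tl p t (at ∷ (z false false) ∷ (z false true) ∷ (z true false) ∷ (z true true) ∷ []) (tl p a (t ∷ at ∷ (z false false) ∷ (z false true) ∷ (z true false) ∷ (z true true) ∷ []) (tl p one (a ∷ t ∷ at ∷ (z false false) ∷ (z false true) ∷ (z true false) ∷ (z true true) ∷ []) q)))))))

R8-assoc : ∀ x y w → (x · y) · w ≡ x · (y · w)
R8-assoc x y w =
  eqb-sound _ _
    (allR8-sound (λ w → eqb ((x · y) · w) (x · (y · w)))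
      (allR8-sound (λ y → allR8 λ w → eqb ((x · y) · w) (x · (y · w)))
        (allR8-sound (λ x → allR8 λ y → allR8 λ w → eqb ((x · y) · w) (x · (y · w))) tt x) y) w)

R8-comm : ∀ x y → x · y ≡ y · x
R8-comm x y =
  eqb-sound _ _
    (allR8-sound (λ y → eqb (x · y) (y · x))
      (allR8-sound (λ x → allR8 λ y → eqb (x · y) (y · x)) tt x) y)

R8-identityˡ : ∀ x → one · x ≡ x
R8-identityˡ x = refl

ℛ₈ : BipartiteMonoid
ℛ₈ = record
  { Carrier = R8 ; _∙_ = _·_ ; ε = one ; P = R8-P
  ; assoc = R8-assoc ; comm = R8-comm ; identityˡ = R8-identityˡ }

-- R₈ is the quotient of the closure of *1, *2 and Gₜ = {*1, *2, *1 + *2, *1 + *2 + *2}, in which these games have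
-- the classes a, z₂ and t. Each game of that closure has a value in R₈ and a profile: its value together with the
-- set of values of its options. The generators' profiles lie in a list of 19 profiles that is closed under sums,
-- and on it the profiles satisfying the misère P-recursion are exactly those with value a or z₀. So by induction
-- the outcome of a game is read off its value, and since R₈ is reduced, values are exactly the classes.
--
-- Conversely, let Q be a quotient with 8 elements. Descending along options inside Q gives an a ≠ 1 whose options
-- are all 1 (so a is the class of *1, a² = 1), then b ∉ {1, a} with options exactly {1, a} (the class of *2), then
-- c outside the six products aʲbⁱ (i ≤ 2) whose options are among them. Which of the six are options of c, one of
-- 64 sets σ, determines the outcome of every aʲbⁱcᵏ. For each σ a table of these outcomes is computed and checked
-- against the misère recursion; with it the eight products 1, a, b, ab, b², ab², c, ac are pairwise distinct, hence
-- all of Q, and the table shows either a contradiction (c equals one of the six products, or b³ or bc differs from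
-- all eight) or that these products multiply and carry P exactly as the elements of R₈, with t ↦ c or t ↦ ac.

module Submission where

open import Defs
open import Data.Fin using (Fin)
open import Data.Product using (_×_)
open import Function.Bundles using (_↔_)

open import Algebra.Bundles using (CommutativeMonoid)
open import Algebra.Structures.Biased using (isCommutativeMonoidˡ)
open import Data.Bool using (Bool; true; false; not; _∧_; _xor_; T)
import Data.Bool as Bool
open import Data.Bool.ListAction using (all)
open import Data.Bool.Properties using (T-≡; ∧-zeroʳ)
open import Data.Empty using (⊥-elim)
import Data.Fin as Fin
open import Data.Fin.Patterns using (0F; 1F; 2F; 3F; 4F; 5F; 6F; 7F)
import Data.Fin.Properties as FinP
open import Data.List using (List; []; _∷_; _++_; map; null; filter; length)
open import Data.List.Membership.Propositional using (_∈_; _∉_; mapWith∈; find)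
open import Data.List.Membership.Propositional.Properties
  using (∈-map⁺; ∈-map⁻; ∈-++⁺ˡ; ∈-++⁺ʳ; ∈-++⁻; ∈-filter⁺; ∈-filter⁻)
import Data.List.Membership.DecPropositional as DecMembership
open import Data.List.Membership.Setoid.Properties using (index-injective)
open import Data.List.Properties
  using (filter-≐; filter-accept; filter-reject; map-id; map-∘; map-cong; map-cong-local; map-++)
  renaming (≡-dec to List-≡-dec)
open import Data.List.Relation.Binary.Subset.Propositional using (_⊆_)
open import Data.List.Relation.Binary.Subset.Propositional.Properties
  using () renaming (map⁺ to ⊆-map⁺; ++⁺ to ⊆-++⁺)
open import Data.List.Relation.Unary.All using (All; []; _∷_; all?)
import Data.List.Relation.Unary.All as All
open import Data.List.Relation.Unary.All.Properties
  using (all⁺; all⁻; ¬Any⇒All¬) renaming (++⁺ to All-++⁺; map⁺ to All-map⁺)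
open import Data.List.Relation.Unary.Any using (Any; any?; here; there)
import Data.List.Relation.Unary.Any as Any
open import Data.List.Relation.Unary.Any.Properties using (mapWith∈⁺; mapWith∈⁻)
open import Data.Nat using (ℕ; zero; suc; _+_; _*_; _≤_; _<_; s≤s; z≤n; _≤?_)
open import Data.Nat.Induction using (<-wellFounded)
open import Data.Nat.Properties
  using (allUpTo?; m≤m+n; m≤n+m; m≤m*n; <⇒≱; n≮n; ≤-refl; ≤-trans; ≤-reflexive; ≤-<-trans;
         +-monoˡ-≤; +-monoʳ-≤; +-monoˡ-<; +-monoʳ-<; module ≤-Reasoning)
open import Data.Nat.Solver using (module +-*-Solver)
open +-*-Solver using (solve; _:+_; _:*_; _:=_; con)
open import Data.Product using (Σ; ∃; ∃₂; _,_; proj₁; proj₂)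
open import Data.Product.Properties using () renaming (≡-dec to ×-≡-dec)
open import Data.Sum using (_⊎_; inj₁; inj₂)
open import Data.Unit using (tt)
open import Function.Base using (_∘_; id)
open import Function.Bundles using (_⇔_; mk⇔; Equivalence; Inverse; mk↔ₛ′)
open import Function.Definitions using (Injective)
open import Function.Properties.Equivalence using () renaming (trans to ⇔-trans; sym to ⇔-sym)
import Induction.WellFounded as WF
open import Level using (0ℓ)
import Relation.Binary.Construct.On as On
open import Relation.Binary.Definitions using (DecidableEquality)
open import Relation.Binary.PropositionalEquality
  using (_≡_; _≢_; refl; sym; trans; cong; cong₂; subst; subst₂; setoid; isEquivalence; module ≡-Reasoning)
open import Relation.Nullary using (¬_; ¬?; Dec; yes; no; contradiction)
open import Relation.Nullary.Decidable
  using (map′; ⌊_⌋; does; decidable-stable; _⊎-dec_; _×-dec_; _→-dec_; toWitness; fromWitness)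
open import Relation.Unary using (Decidable)

sumOptions : {X : Set} → (X → X → X) → X → X → List X → List X → List X
sumOptions _∙_ x y S S′ = map (_∙ y) S ++ map (x ∙_) S′

plusL≡map : ∀ gs H → plusL gs H ≡ map (_+G H) gs
plusL≡map []       H = refl
plusL≡map (g ∷ gs) H = cong (g +G H ∷_) (plusL≡map gs H)

plusR≡map : ∀ G hs → plusR G hs ≡ map (G +G_) hs
plusR≡map G []       = refl
plusR≡map G (h ∷ hs) = cong (G +G h ∷_) (plusR≡map G hs)

options-+G : ∀ G H → options (G +G H) ≡ sumOptions _+G_ G H (options G) (options H)
options-+G (mk gs) (mk hs) = cong₂ _++_ (plusL≡map gs (mk hs)) (plusR≡map (mk gs) hs)

∈-options-+G⁻ : ∀ G H {K} → K ∈ options (G +G H) →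
                (∃ λ G′ → G′ ∈ options G × K ≡ G′ +G H)
              ⊎ (∃ λ H′ → H′ ∈ options H × K ≡ G +G H′)
∈-options-+G⁻ G H m with ∈-++⁻ (map (_+G H) (options G)) (subst (_ ∈_) (options-+G G H) m)
... | inj₁ m′ = inj₁ (∈-map⁻ (_+G H) m′)
... | inj₂ m′ = inj₂ (∈-map⁻ (G +G_) m′)

∈-options-+Gˡ : ∀ G H {G′} → G′ ∈ options G → G′ +G H ∈ options (G +G H)
∈-options-+Gˡ G H m = subst (_ ∈_) (sym (options-+G G H)) (∈-++⁺ˡ (∈-map⁺ (_+G H) m))

∈-options-+Gʳ : ∀ G H {H′} → H′ ∈ options H → G +G H′ ∈ options (G +G H)
∈-options-+Gʳ G H m = subst (_ ∈_) (sym (options-+G G H)) (∈-++⁺ʳ (map (_+G H) (options G)) (∈-map⁺ (G +G_) m))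

game-ind : (Q : Game → Set) → (∀ G → (∀ {G′} → G′ ∈ options G → Q G′) → Q G) → ∀ G → Q G
game-ind Q step (mk gs) = step (mk gs) (below gs)
  where
  below : ∀ gs {G′} → G′ ∈ gs → Q G′
  below (g ∷ gs) (here refl) = game-ind Q step g
  below (g ∷ gs) (there m)   = below gs m

allN≡all : ∀ gs → allN gs ≡ all (not ∘ isP) gs
allN≡all []       = refl
allN≡all (g ∷ gs) = cong (not (isP g) ∧_) (allN≡all gs)

outcomeRule : {X : Set} → (X → Bool) → List X → Bool
outcomeRule f xs = not (null xs) ∧ all (not ∘ f) xs

isP-options : ∀ G → isP G ≡ outcomeRule isP (options G)
isP-options (mk [])       = refl
isP-options (mk (g ∷ gs)) = allN≡all (g ∷ gs)

NonEmpty : {X : Set} → List X → Set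
NonEmpty xs = ∃ (_∈ xs)

T-outcomeRule : {X : Set} (f : X → Bool) (xs : List X) →
                T (outcomeRule f xs) ⇔ (NonEmpty xs × All (T ∘ not ∘ f) xs)
T-outcomeRule f []       = mk⇔ (λ ()) (λ { ((_ , ()) , _) })
T-outcomeRule f (x ∷ xs) = mk⇔ (λ h → (x , here refl) , all⁺ (not ∘ f) (x ∷ xs) h)
                               (λ (_ , h) → all⁻ (not ∘ f) h)

T-injective : ∀ {b c} → T b ⇔ T c → b ≡ c
T-injective {false} {false} _   = refl
T-injective {false} {true}  b⇔c = ⊥-elim (Equivalence.from b⇔c tt)
T-injective {true}  {false} b⇔c = ⊥-elim (Equivalence.to b⇔c tt)
T-injective {true}  {true}  _   = refl

outcomeRule-transfer : {X Y : Set} (f : X → Bool) (g : Y → Bool) {xs : List X} {ys : List Y} →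
                       (∀ {x} → x ∈ xs → ∃ λ y → y ∈ ys × f x ≡ g y) →
                       (∀ {y} → y ∈ ys → ∃ λ x → x ∈ xs × f x ≡ g y) →
                       outcomeRule f xs ≡ outcomeRule g ys
outcomeRule-transfer f g xs→ys ys→xs = T-injective (mk⇔
  (transport f g (λ (_ , m) → let y , m′ , _ = xs→ys m in y , m′) ys→xs)
  (transport g f (λ (_ , m) → let x , m′ , _ = ys→xs m in x , m′)
                 (λ m → let y , m′ , e = xs→ys m in y , m′ , sym e)))
  where
  transport : ∀ {X Y : Set} (f : X → Bool) (g : Y → Bool) {xs : List X} {ys : List Y} →
              (NonEmpty xs → NonEmpty ys) →
              (∀ {y} → y ∈ ys → ∃ λ x → x ∈ xs × f x ≡ g y) →
              T (outcomeRule f xs) → T (outcomeRule g ys)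
  transport f g {xs} {ys} nonEmpty ys→xs h =
    let ne , nf = Equivalence.to (T-outcomeRule f xs) h
    in Equivalence.from (T-outcomeRule g ys)
         (nonEmpty ne , All.tabulate λ m → let x , m′ , e = ys→xs m in subst (T ∘ not) e (All.lookup nf m′))

outcomeRule-cong : {X : Set} (f : X → Bool) {xs ys : List X} → xs ⊆ ys → ys ⊆ xs →
                   outcomeRule f xs ≡ outcomeRule f ys
outcomeRule-cong f xs⊆ys ys⊆xs = outcomeRule-transfer f f (λ m → _ , xs⊆ys m , refl) (λ m → _ , ys⊆xs m , refl)

outcomeRule-map : {X Y : Set} (f : Y → Bool) (g : X → Y) (xs : List X) →
                  outcomeRule f (map g xs) ≡ outcomeRule (f ∘ g) xs
outcomeRule-map f g xs = outcomeRule-transfer f (f ∘ g) {map g xs} {xs}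
  (λ m → let x , mx , e = ∈-map⁻ g m in x , mx , cong f e)
  (λ m → _ , ∈-map⁺ g m , refl)

outcomeRule-pointwise : {X : Set} {f g : X → Bool} {xs : List X} → All (λ x → f x ≡ g x) xs →
                        outcomeRule f xs ≡ outcomeRule g xs
outcomeRule-pointwise {f = f} {g} {xs} same =
  outcomeRule-transfer f g {xs} {xs} (λ m → _ , m , All.lookup same m) (λ m → _ , m , All.lookup same m)

outcomeRule-++-map : {X Y : Set} (f : X → Bool) (xs : List X) {g h : Y → X} {ys : List Y} →
                     All (λ y → f (g y) ≡ f (h y)) ys →
                     outcomeRule f (xs ++ map g ys) ≡ outcomeRule f (xs ++ map h ys)
outcomeRule-++-map f xs {g} {h} {ys} same = outcomeRule-transfer f f
  (corresponding g h same)
  (λ m → let v , m′ , e = corresponding h g (All.map sym same) m in v , m′ , sym e)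
  where
  corresponding : (g h : _ → _) → All (λ y → f (g y) ≡ f (h y)) ys →
                  ∀ {v} → v ∈ xs ++ map g ys → ∃ λ v′ → v′ ∈ xs ++ map h ys × f v ≡ f v′
  corresponding g h same m with ∈-++⁻ xs m
  ... | inj₁ m′ = _ , ∈-++⁺ˡ m′ , refl
  ... | inj₂ m′ with ∈-map⁻ g m′
  ...   | y , my , refl = h y , ∈-++⁺ʳ xs (∈-map⁺ h my) , All.lookup same my

module Finite {X : Set} {n : ℕ} (X↔Fin : X ↔ Fin n) where
  open Inverse X↔Fin using (to; from; strictlyInverseˡ; strictlyInverseʳ)

  to-injective : ∀ {x y} → to x ≡ to y → x ≡ y
  to-injective {x} {y} e = trans (sym (strictlyInverseʳ x)) (trans (cong from e) (strictlyInverseʳ y))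

  infix 4 _≟_
  _≟_ : DecidableEquality X
  x ≟ y = map′ to-injective (cong to) (to x Fin.≟ to y)

  open DecMembership _≟_ public using (_∈?_)

  ∀? : {P : X → Set} → Decidable P → Dec (∀ x → P x)
  ∀? {P} P? = map′ (λ h x → subst P (strictlyInverseʳ x) (h (to x))) (λ h i → h (from i)) (FinP.all? (P? ∘ from))

  ¬∀⇒∃¬ : {P : X → Set} → Decidable P → ¬ (∀ x → P x) → ∃ λ x → ¬ P x
  ¬∀⇒∃¬ {P} P? ¬∀ =
    let i , ¬P = FinP.¬∀⟶∃¬ n (P ∘ from) (P? ∘ from) (λ h → ¬∀ λ x → subst P (strictlyInverseʳ x) (h (to x)))
    in from i , ¬P

  ∃-∉ : (xs : List X) → length xs < n → ∃ (_∉ xs)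
  ∃-∉ xs short with ∀? (_∈? xs)
  ... | no ¬covered = ¬∀⇒∃¬ (_∈? xs) ¬covered
  ... | yes covered = contradiction (FinP.injective⇒≤ position-injective) (<⇒≱ short)
    where
    position : Fin n → Fin (length xs)
    position i = Any.index (covered (from i))
    position-injective : Injective _≡_ _≡_ position
    position-injective {i} {j} e =
      trans (sym (strictlyInverseˡ i))
            (trans (cong to (index-injective (setoid X) (covered (from i)) (covered (from j)) e))
                   (strictlyInverseˡ j))

  injective⇒surjective : {Y : Set} → Y ↔ Fin n → (f : Y → X) → Injective _≡_ _≡_ f →
                         ∀ x → ∃ λ y → f y ≡ x
  injective⇒surjective Y↔Fin f f-injective x = hit (FinP.any? (λ i → g i Fin.≟ to x))
    where
    open Inverse Y↔Fin using () renaming (to to toY; from to fromY; strictlyInverseˡ to toY-fromY)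
    g : Fin n → Fin n
    g = to ∘ f ∘ fromY
    g-injective : Injective _≡_ _≡_ g
    g-injective {i} {j} e =
      trans (sym (toY-fromY i)) (trans (cong toY (f-injective (to-injective e))) (toY-fromY j))
    hit : Dec (∃ λ i → g i ≡ to x) → ∃ λ y → f y ≡ x
    hit (yes (i , e)) = fromY i , to-injective e
    hit (no missed)   = contradiction (FinP.injective⇒≤ h-injective) (n≮n n)
      where
      h : Fin (suc n) → Fin n
      h Fin.zero    = to x
      h (Fin.suc i) = g i
      h-injective : Injective _≡_ _≡_ h
      h-injective {Fin.zero}  {Fin.zero}  _ = refl
      h-injective {Fin.zero}  {Fin.suc j} e = contradiction (j , sym e) missed
      h-injective {Fin.suc i} {Fin.zero}  e = contradiction (i , e) missed
      h-injective {Fin.suc i} {Fin.suc j} e = cong Fin.suc (g-injective e)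

commutativeMonoid : BipartiteMonoid → CommutativeMonoid 0ℓ 0ℓ
commutativeMonoid M = record
  { isCommutativeMonoid = isCommutativeMonoidˡ record
    { isSemigroup = record
      { isMagma = record { isEquivalence = isEquivalence ; ∙-cong = cong₂ _∙_ }
      ; assoc   = assoc
      }
    ; identityˡ = identityˡ
    ; comm      = comm
    }
  }
  where open BipartiteMonoid M

bijective-hom⇒Iso : (M N : BipartiteMonoid) (g : BipartiteMonoid.Carrier N → BipartiteMonoid.Carrier M) →
                    Injective _≡_ _≡_ g → (∀ m → ∃ λ x → g x ≡ m) →
                    (∀ x y → g (BipartiteMonoid._∙_ N x y) ≡ BipartiteMonoid._∙_ M (g x) (g y)) →
                    g (BipartiteMonoid.ε N) ≡ BipartiteMonoid.ε M →
                    (∀ x → BipartiteMonoid.P N x ⇔ BipartiteMonoid.P M (g x)) → Iso M N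
bijective-hom⇒Iso M N g g-injective g-surjective g-hom g-ε g-P = record
  { to      = to
  ; from    = g
  ; from-to = g-to
  ; to-from = λ x → g-injective (g-to (g x))
  ; hom     = λ m m′ → g-injective (begin
      g (to (m M.∙ m′))       ≡⟨ g-to (m M.∙ m′) ⟩
      m M.∙ m′                ≡⟨ cong₂ M._∙_ (g-to m) (g-to m′) ⟨
      g (to m) M.∙ g (to m′)  ≡⟨ g-hom (to m) (to m′) ⟨
      g (to m N.∙ to m′)      ∎)
  ; hom-ε   = g-injective (trans (g-to M.ε) (sym g-ε))
  ; hom-P   = λ m → subst (λ m′ → M.P m′ ⇔ N.P (to m)) (g-to m) (⇔-sym (g-P (to m)))
  }
  where
  module M = BipartiteMonoid M
  module N = BipartiteMonoid N
  open ≡-Reasoning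
  to : M.Carrier → N.Carrier
  to m = proj₁ (g-surjective m)
  g-to : ∀ m → g (to m) ≡ m
  g-to m = proj₂ (g-surjective m)

pattern z₀ = z false false
pattern z₁ = z false true
pattern z₂ = z true  false
pattern z₃ = z true  true

R8↔Fin8 : R8 ↔ Fin 8
R8↔Fin8 = mk↔ₛ′ code decode code-decode decode-code
  where
  code : R8 → Fin 8
  code one = 0F
  code a   = 1F
  code t   = 2F
  code at  = 3F
  code z₀  = 4F
  code z₁  = 5F
  code z₂  = 6F
  code z₃  = 7F
  decode : Fin 8 → R8
  decode 0F = one
  decode 1F = a
  decode 2F = t
  decode 3F = at
  decode 4F = z₀
  decode 5F = z₁
  decode 6F = z₂
  decode 7F = z₃
  code-decode : ∀ i → code (decode i) ≡ i
  code-decode 0F = refl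
  code-decode 1F = refl
  code-decode 2F = refl
  code-decode 3F = refl
  code-decode 4F = refl
  code-decode 5F = refl
  code-decode 6F = refl
  code-decode 7F = refl
  decode-code : ∀ x → decode (code x) ≡ x
  decode-code one = refl
  decode-code a   = refl
  decode-code t   = refl
  decode-code at  = refl
  decode-code z₀  = refl
  decode-code z₁  = refl
  decode-code z₂  = refl
  decode-code z₃  = refl

module R8-Finite = Finite R8↔Fin8
open R8-Finite using () renaming (_≟_ to _≟ᴿ_; _∈?_ to _∈ᴿ?_)

R8-P? : ∀ x → Dec (R8-P x)
R8-P? x = (x ≟ᴿ a) ⊎-dec (x ≟ᴿ z₀)

isPᴿ : R8 → Bool
isPᴿ x = ⌊ R8-P? x ⌋

R8-P⇔isPᴿ : ∀ x → R8-P x ⇔ T (isPᴿ x)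
R8-P⇔isPᴿ x = mk⇔ (fromWitness {a? = R8-P? x}) (toWitness {a? = R8-P? x})

elements : List R8
elements = one ∷ a ∷ t ∷ at ∷ z₀ ∷ z₁ ∷ z₂ ∷ z₃ ∷ []

∈-elements : ∀ x → x ∈ elements
∈-elements one = here refl
∈-elements a   = there (here refl)
∈-elements t   = there (there (here refl))
∈-elements at  = there (there (there (here refl)))
∈-elements z₀  = there (there (there (there (here refl))))
∈-elements z₁  = there (there (there (there (there (here refl)))))
∈-elements z₂  = there (there (there (there (there (there (here refl))))))
∈-elements z₃  = there (there (there (there (there (there (there (here refl)))))))

Distinguishable : R8 → R8 → Set
Distinguishable x y = Any (λ w → isPᴿ (x · w) ≢ isPᴿ (y · w)) elements

distinguishable : All (λ x → All (λ y → x ≡ y ⊎ Distinguishable x y) elements) elements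
distinguishable = toWitness {a? = all? (λ x → all? (λ y → (x ≟ᴿ y) ⊎-dec distinguishable? x y) elements) elements} tt
  where
  distinguishable? : ∀ x y → Dec (Distinguishable x y)
  distinguishable? x y = any? (λ w → ¬? (isPᴿ (x · w) Bool.≟ isPᴿ (y · w))) elements

R8-reduced : ∀ x y → (∀ w → isPᴿ (x · w) ≡ isPᴿ (y · w)) → x ≡ y
R8-reduced x y same = resolve (All.lookup (All.lookup distinguishable (∈-elements x)) (∈-elements y))
  where
  resolve : x ≡ y ⊎ Distinguishable x y → x ≡ y
  resolve (inj₁ x≡y)    = x≡y
  resolve (inj₂ differ) = let w , isPᴿ≢ = Any.satisfied differ in contradiction (same w) isPᴿ≢

-- R₈ is a misère quotient

*1 *2 Gₜ : Game
*1 = mk (𝟎 ∷ [])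
*2 = mk (𝟎 ∷ *1 ∷ [])
Gₜ = mk (*1 ∷ *2 ∷ *1 +G *2 ∷ *1 +G (*2 +G *2) ∷ [])

data Generated : Game → Set where
  𝟎ᵍ  : Generated 𝟎
  *1ᵍ : Generated *1
  *2ᵍ : Generated *2
  Gₜᵍ : Generated Gₜ
  _+ᵍ_ : ∀ {G H} → Generated G → Generated H → Generated (G +G H)

value : ∀ {G} → Generated G → R8
value 𝟎ᵍ       = one
value *1ᵍ      = a
value *2ᵍ      = z₂
value Gₜᵍ      = t
value (p +ᵍ q) = value p · value q

optionValues : ∀ {G} → Generated G → List R8
optionValues 𝟎ᵍ       = []
optionValues *1ᵍ      = one ∷ []
optionValues *2ᵍ      = one ∷ a ∷ []
optionValues Gₜᵍ      = a ∷ z₂ ∷ z₃ ∷ z₁ ∷ []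
optionValues (p +ᵍ q) = sumOptions _·_ (value p) (value q) (optionValues p) (optionValues q)

option-generated : ∀ {G G′} (p : Generated G) → G′ ∈ options G →
                   Σ (Generated G′) λ p′ → value p′ ∈ optionValues p
option-generated *1ᵍ (here refl)                             = 𝟎ᵍ , here refl
option-generated *2ᵍ (here refl)                             = 𝟎ᵍ , here refl
option-generated *2ᵍ (there (here refl))                     = *1ᵍ , there (here refl)
option-generated Gₜᵍ (here refl)                             = *1ᵍ , here refl
option-generated Gₜᵍ (there (here refl))                     = *2ᵍ , there (here refl)
option-generated Gₜᵍ (there (there (here refl)))             = *1ᵍ +ᵍ *2ᵍ , there (there (here refl))
option-generated Gₜᵍ (there (there (there (here refl))))     = *1ᵍ +ᵍ (*2ᵍ +ᵍ *2ᵍ) , there (there (there (here refl)))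
option-generated (_+ᵍ_ {G} {H} p q) m with ∈-options-+G⁻ G H m
... | inj₁ (G′ , m′ , refl) = let p′ , v = option-generated p m′ in
  p′ +ᵍ q , ∈-++⁺ˡ (∈-map⁺ (_· value q) v)
... | inj₂ (H′ , m′ , refl) = let q′ , v = option-generated q m′ in
  p +ᵍ q′ , ∈-++⁺ʳ (map (_· value q) (optionValues p)) (∈-map⁺ (value p ·_) v)

optionValue-option : ∀ {G v} (p : Generated G) → v ∈ optionValues p →
                     ∃ λ G′ → G′ ∈ options G × Σ (Generated G′) λ p′ → value p′ ≡ v
optionValue-option *1ᵍ (here refl)                         = _ , here refl , 𝟎ᵍ , refl
optionValue-option *2ᵍ (here refl)                         = _ , here refl , 𝟎ᵍ , refl
optionValue-option *2ᵍ (there (here refl))                 = _ , there (here refl) , *1ᵍ , refl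
optionValue-option Gₜᵍ (here refl)                         = _ , here refl , *1ᵍ , refl
optionValue-option Gₜᵍ (there (here refl))                 = _ , there (here refl) , *2ᵍ , refl
optionValue-option Gₜᵍ (there (there (here refl)))         = _ , there (there (here refl)) , *1ᵍ +ᵍ *2ᵍ , refl
optionValue-option Gₜᵍ (there (there (there (here refl)))) = _ , there (there (there (here refl))) , *1ᵍ +ᵍ (*2ᵍ +ᵍ *2ᵍ) , refl
optionValue-option (_+ᵍ_ {G} {H} p q) m with ∈-++⁻ (map (_· value q) (optionValues p)) m
... | inj₁ m′ = let v , mv , e = ∈-map⁻ (_· value q) m′
                    G′ , mG′ , p′ , e′ = optionValue-option p mv
                in G′ +G H , ∈-options-+Gˡ G H mG′ , p′ +ᵍ q , trans (cong (_· value q) e′) (sym e)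
... | inj₂ m′ = let v , mv , e = ∈-map⁻ (value p ·_) m′
                    H′ , mH′ , q′ , e′ = optionValue-option q mv
                in G +G H′ , ∈-options-+Gʳ G H mH′ , p +ᵍ q′ , trans (cong (value p ·_) e′) (sym e)

-- Filtering the fixed list of elements makes lists with the same members equal, so profiles are compared by _≡_.
normalise : List R8 → List R8
normalise S = filter (_∈ᴿ? S) elements

∈-normalise : ∀ {v} S → v ∈ normalise S ⇔ v ∈ S
∈-normalise S = mk⇔ (proj₂ ∘ ∈-filter⁻ (_∈ᴿ? S)) (∈-filter⁺ (_∈ᴿ? S) (∈-elements _))

normalise-cong : ∀ {S S′} → S ⊆ S′ → S′ ⊆ S → normalise S ≡ normalise S′
normalise-cong S⊆S′ S′⊆S = filter-≐ (_∈ᴿ? _) (_∈ᴿ? _) (S⊆S′ , S′⊆S) elements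

Profile : Set
Profile = R8 × List R8

profile : ∀ {G} → Generated G → Profile
profile p = value p , normalise (optionValues p)

sumProfile : Profile → Profile → Profile
sumProfile (x , S) (y , S′) = x · y , normalise (sumOptions _·_ x y S S′)

profile-+ᵍ : ∀ {G H} (p : Generated G) (q : Generated H) →
             profile (p +ᵍ q) ≡ sumProfile (profile p) (profile q)
profile-+ᵍ p q = cong (value p · value q ,_) (normalise-cong
  (⊆-++⁺ (⊆-map⁺ _ (from (∈-normalise (optionValues p)))) (⊆-map⁺ _ (from (∈-normalise (optionValues q)))))
  (⊆-++⁺ (⊆-map⁺ _ (to (∈-normalise (optionValues p)))) (⊆-map⁺ _ (to (∈-normalise (optionValues q))))))
  where open Equivalence

profiles : List Profile
profiles =
    (one , [])
  ∷ (one , a ∷ [])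
  ∷ (a   , one ∷ [])
  ∷ (at  , one ∷ t ∷ z₀ ∷ z₂ ∷ z₃ ∷ [])
  ∷ (t   , a ∷ at ∷ z₁ ∷ z₂ ∷ z₃ ∷ [])
  ∷ (t   , a ∷ z₁ ∷ z₂ ∷ z₃ ∷ [])
  ∷ (z₀  , at ∷ z₁ ∷ z₂ ∷ z₃ ∷ [])
  ∷ (z₀  , z₁ ∷ z₂ ∷ z₃ ∷ [])
  ∷ (z₀  , z₂ ∷ z₃ ∷ [])
  ∷ (z₁  , t ∷ z₀ ∷ z₂ ∷ z₃ ∷ [])
  ∷ (z₁  , z₀ ∷ z₂ ∷ z₃ ∷ [])
  ∷ (z₂  , one ∷ a ∷ [])
  ∷ (z₂  , one ∷ a ∷ z₃ ∷ [])
  ∷ (z₂  , t ∷ at ∷ z₀ ∷ z₁ ∷ z₃ ∷ [])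
  ∷ (z₂  , z₀ ∷ z₁ ∷ [])
  ∷ (z₂  , z₀ ∷ z₁ ∷ z₃ ∷ [])
  ∷ (z₃  , one ∷ a ∷ z₂ ∷ [])
  ∷ (z₃  , t ∷ at ∷ z₀ ∷ z₁ ∷ z₂ ∷ [])
  ∷ (z₃  , z₀ ∷ z₁ ∷ z₂ ∷ [])
  ∷ []

_≟ᴾ_ : DecidableEquality Profile
_≟ᴾ_ = ×-≡-dec _≟ᴿ_ (List-≡-dec _≟ᴿ_)

profiles-closed : All (λ π → All (λ π′ → sumProfile π π′ ∈ profiles) profiles) profiles
profiles-closed = toWitness {a? = all? (λ π → all? (λ π′ → sumProfile π π′ ∈ᴾ? profiles) profiles) profiles} tt
  where open DecMembership _≟ᴾ_ using () renaming (_∈?_ to _∈ᴾ?_)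

profiles-outcome : All (λ (x , S) → isPᴿ x ≡ outcomeRule isPᴿ S) profiles
profiles-outcome = toWitness {a? = all? (λ (x , S) → isPᴿ x Bool.≟ outcomeRule isPᴿ S) profiles} tt

profile∈profiles : ∀ {G} (p : Generated G) → profile p ∈ profiles
profile∈profiles 𝟎ᵍ       = here refl
profile∈profiles *1ᵍ      = there (there (here refl))
profile∈profiles *2ᵍ      = there (there (there (there (there (there (there (there (there (there (there (here refl)))))))))))
profile∈profiles Gₜᵍ      = there (there (there (there (there (here refl)))))
profile∈profiles (p +ᵍ q) = subst (_∈ profiles) (sym (profile-+ᵍ p q))
  (All.lookup (All.lookup profiles-closed (profile∈profiles p)) (profile∈profiles q))

outcome : ∀ {G} (p : Generated G) → isP G ≡ isPᴿ (value p)
outcome {G} = game-ind (λ G → (p : Generated G) → isP G ≡ isPᴿ (value p)) step G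
  where
  step : ∀ G → (∀ {G′} → G′ ∈ options G → (p′ : Generated G′) → isP G′ ≡ isPᴿ (value p′)) →
         (p : Generated G) → isP G ≡ isPᴿ (value p)
  step G ih p = begin
    isP G                                          ≡⟨ isP-options G ⟩
    outcomeRule isP (options G)                    ≡⟨ outcomeRule-transfer isP isPᴿ options→values values→options ⟩
    outcomeRule isPᴿ (optionValues p)              ≡⟨ outcomeRule-cong isPᴿ (from (∈-normalise S)) (to (∈-normalise S)) ⟩
    outcomeRule isPᴿ (normalise (optionValues p))  ≡⟨ sym (All.lookup profiles-outcome (profile∈profiles p)) ⟩
    isPᴿ (value p)                                 ∎
    where
    open ≡-Reasoning
    open Equivalence
    S = optionValues p
    options→values : ∀ {G′} → G′ ∈ options G → ∃ λ v → v ∈ optionValues p × isP G′ ≡ isPᴿ v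
    options→values m = let p′ , v = option-generated p m in value p′ , v , ih m p′
    values→options : ∀ {v} → v ∈ optionValues p → ∃ λ G′ → G′ ∈ options G × isP G′ ≡ isPᴿ v
    values→options m = let G′ , m′ , p′ , e = optionValue-option p m in
      G′ , m′ , trans (ih m′ p′) (cong isPᴿ e)

generated-closed : Closed Generated
generated-closed = record
  { has-𝟎          = 𝟎ᵍ
  ; options-closed = λ _ _ p m → proj₁ (option-generated p m)
  ; sum-closed     = λ _ _ → _+ᵍ_
  }

representative : ∀ x → ∃ λ G → Σ (Generated G) λ p → value p ≡ x
representative one = _ , 𝟎ᵍ , refl
representative a   = _ , *1ᵍ , refl
representative t   = _ , Gₜᵍ , refl
representative at  = _ , *1ᵍ +ᵍ Gₜᵍ , refl
representative z₀  = _ , *2ᵍ +ᵍ *2ᵍ , refl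
representative z₁  = _ , *1ᵍ +ᵍ (*2ᵍ +ᵍ *2ᵍ) , refl
representative z₂  = _ , *2ᵍ , refl
representative z₃  = _ , *1ᵍ +ᵍ *2ᵍ , refl

value-kernel : ∀ {G H} (p : Generated G) (q : Generated H) → (value p ≡ value q) ⇔ Indist Generated G H
value-kernel {G} {H} p q = mk⇔ indistinguishable same-value
  where
  indistinguishable : value p ≡ value q → Indist Generated G H
  indistinguishable e X r = begin
    isP (G +G X)             ≡⟨ outcome (p +ᵍ r) ⟩
    isPᴿ (value p · value r) ≡⟨ cong (λ v → isPᴿ (v · value r)) e ⟩
    isPᴿ (value q · value r) ≡⟨ outcome (q +ᵍ r) ⟨
    isP (H +G X)             ∎
    where open ≡-Reasoning
  same-value : Indist Generated G H → value p ≡ value q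
  same-value indist = R8-reduced (value p) (value q) λ w →
    let X , r , e = representative w in begin
    isPᴿ (value p · w)       ≡⟨ cong (λ v → isPᴿ (value p · v)) e ⟨
    isPᴿ (value p · value r) ≡⟨ outcome (p +ᵍ r) ⟨
    isP (G +G X)             ≡⟨ indist X r ⟩
    isP (H +G X)             ≡⟨ outcome (q +ᵍ r) ⟩
    isPᴿ (value q · value r) ≡⟨ cong (λ v → isPᴿ (value q · v)) e ⟩
    isPᴿ (value q · w)       ∎
    where open ≡-Reasoning

value-irrelevant : ∀ {G} (p p′ : Generated G) → value p ≡ value p′
value-irrelevant p p′ = Equivalence.from (value-kernel p p′) (λ _ _ → refl)

R8-isMisereQuotient : IsMisereQuotient ℛ₈
R8-isMisereQuotient = Generated , generated-closed , record
  { φ      = λ (_ , p) → value p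
  ; surj   = λ x → let _ , p , e = representative x in (_ , p) , e
  ; kernel = λ _ _ → value-kernel
  ; hom    = λ _ _ p q pq → value-irrelevant pq (p +ᵍ q)
  ; hom-𝟎  = λ z → value-irrelevant z 𝟎ᵍ
  ; hom-P  = λ G p → ⇔-trans (R8-P⇔isPᴿ (value p)) (subst (λ b → T b ⇔ (isP G ≡ true)) (outcome p) T-≡)
  }

-- Presentations of a misère quotient

module Presentation {A : Game → Set} {M : BipartiteMonoid} (closed : Closed A) (presents : Presents A M) where
  open BipartiteMonoid M
  open Closed closed
  open Presents presents
  open CommutativeMonoid (commutativeMonoid M) using (identityʳ)
  open Equivalence

  infix 4 _has-class_
  _has-class_ : Game → Carrier → Set
  G has-class x = Σ (A G) λ g → φ (G , g) ≡ x

  class-∙ : ∀ {G H x y} → G has-class x → H has-class y → G +G H has-class x ∙ y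
  class-∙ {G} {H} (g , refl) (h , refl) = sum-closed G H g h , hom G H g h _

  class-𝟎 : 𝟎 has-class ε
  class-𝟎 = has-𝟎 , hom-𝟎 has-𝟎

  class-exists : ∀ x → ∃ (_has-class x)
  class-exists x = let (G , g) , e = surj x in G , g , e

  P⇔isP : ∀ {G x} → G has-class x → P x ⇔ (isP G ≡ true)
  P⇔isP {G} (g , refl) = hom-P G g

  isPᶜ : Carrier → Bool
  isPᶜ x = isP (proj₁ (class-exists x))

  isPᶜ-class : ∀ {G x} → G has-class x → isPᶜ x ≡ isP G
  isPᶜ-class c = T-injective (⇔-trans T-≡ (⇔-trans (⇔-sym (P⇔isP (proj₂ (class-exists _))))
                                                  (⇔-trans (P⇔isP c) (⇔-sym T-≡))))

  P⇔isPᶜ : ∀ x → P x ⇔ T (isPᶜ x)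
  P⇔isPᶜ x = ⇔-trans (P⇔isP (proj₂ (class-exists x))) (⇔-sym T-≡)

  reduced : ∀ x y → (∀ w → isPᶜ (x ∙ w) ≡ isPᶜ (y ∙ w)) → x ≡ y
  reduced x y same with class-exists x | class-exists y
  ... | G , g , refl | H , h , refl = from (kernel G H g h) λ X r → begin
    isP (G +G X)         ≡⟨ isPᶜ-class (class-∙ (g , refl) (r , refl)) ⟨
    isPᶜ (x ∙ φ (X , r)) ≡⟨ same (φ (X , r)) ⟩
    isPᶜ (y ∙ φ (X , r)) ≡⟨ isPᶜ-class (class-∙ (h , refl) (r , refl)) ⟩
    isP (H +G X)         ∎
    where open ≡-Reasoning

  record Realisation (x : Carrier) (S : List Carrier) : Set where
    field
      game         : Game
      game-class   : game has-class x
      option-class : ∀ {G′} → G′ ∈ options game → ∃ λ s → s ∈ S × G′ has-class s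
      class-option : ∀ {s} → s ∈ S → ∃ λ G′ → G′ ∈ options game × G′ has-class s
  open Realisation

  isPᶜ-realisation : ∀ {x S} → Realisation x S → isPᶜ x ≡ outcomeRule isPᶜ S
  isPᶜ-realisation {x} {S} R = begin
    isPᶜ x                             ≡⟨ isPᶜ-class (game-class R) ⟩
    isP (game R)                       ≡⟨ isP-options (game R) ⟩
    outcomeRule isP (options (game R)) ≡⟨ outcomeRule-transfer isP isPᶜ {options (game R)} {S}
                                            (λ m → let s , m′ , c = option-class R m in
                                                   s , m′ , sym (isPᶜ-class c))
                                            (λ m → let G′ , m′ , c = class-option R m in
                                                   G′ , m′ , sym (isPᶜ-class c)) ⟩
    outcomeRule isPᶜ S                 ∎
    where open ≡-Reasoning

  realisation-𝟎 : Realisation ε []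
  realisation-𝟎 = record { game = 𝟎 ; game-class = class-𝟎 ; option-class = λ () ; class-option = λ () }

  realisation-∙ : ∀ {x y S S′} → Realisation x S → Realisation y S′ →
                  Realisation (x ∙ y) (sumOptions _∙_ x y S S′)
  realisation-∙ {x} {y} {S} {S′} R R′ = record
    { game         = game R +G game R′
    ; game-class   = class-∙ (game-class R) (game-class R′)
    ; option-class = option-class-∙
    ; class-option = class-option-∙
    }
    where
    option-class-∙ : ∀ {K} → K ∈ options (game R +G game R′) →
                     ∃ λ s → s ∈ sumOptions _∙_ x y S S′ × K has-class s
    option-class-∙ m with ∈-options-+G⁻ (game R) (game R′) m
    ... | inj₁ (G′ , m′ , refl) = let s , ms , c = option-class R m′ in
      s ∙ y , ∈-++⁺ˡ (∈-map⁺ (_∙ y) ms) , class-∙ c (game-class R′)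
    ... | inj₂ (H′ , m′ , refl) = let s , ms , c = option-class R′ m′ in
      x ∙ s , ∈-++⁺ʳ (map (_∙ y) S) (∈-map⁺ (x ∙_) ms) , class-∙ (game-class R) c
    class-option-∙ : ∀ {v} → v ∈ sumOptions _∙_ x y S S′ →
                     ∃ λ K → K ∈ options (game R +G game R′) × K has-class v
    class-option-∙ m with ∈-++⁻ (map (_∙ y) S) m
    ... | inj₁ m′ = let s , ms , e = ∈-map⁻ (_∙ y) m′ ; G′ , mG′ , c = class-option R ms in
      G′ +G game R′ , ∈-options-+Gˡ (game R) (game R′) mG′ ,
      subst (G′ +G game R′ has-class_) (sym e) (class-∙ c (game-class R′))
    ... | inj₂ m′ = let s , ms , e = ∈-map⁻ (x ∙_) m′ ; H′ , mH′ , c = class-option R′ ms in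
      game R +G H′ , ∈-options-+Gʳ (game R) (game R′) mH′ ,
      subst (game R +G H′ has-class_) (sym e) (class-∙ (game-class R) c)

  realisation-resp : ∀ {x S S′} → S ⊆ S′ → S′ ⊆ S → Realisation x S → Realisation x S′
  realisation-resp S⊆S′ S′⊆S R = record
    { game         = game R
    ; game-class   = game-class R
    ; option-class = λ m → let s , ms , c = option-class R m in s , S⊆S′ ms , c
    ; class-option = λ m → class-option R (S′⊆S m)
    }

  optionClasses : ∀ {G} → A G → List Carrier
  optionClasses {G} g = mapWith∈ (options G) (λ m → φ (_ , options-closed G _ g m))

  realisation-of : ∀ {G} (g : A G) → Realisation (φ (G , g)) (optionClasses g)
  realisation-of {G} g = record
    { game         = G
    ; game-class   = g , refl
    ; option-class = λ m → _ , mapWith∈⁺ _ (_ , m , refl) , options-closed G _ g m , refl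
    ; class-option = λ m → let G′ , m′ , e = mapWith∈⁻ (options G) _ m in
                           G′ , m′ , options-closed G G′ g m′ , sym e
    }

  class-ind : (Q : Carrier → Set) → (∀ {x S} → Realisation x S → All Q S → Q x) → ∀ x → Q x
  class-ind Q step x = let G , c = class-exists x in game-ind (λ G → ∀ {x} → G has-class x → Q x) go G c
    where
    go : ∀ G → (∀ {G′} → G′ ∈ options G → ∀ {x} → G′ has-class x → Q x) →
         ∀ {x} → G has-class x → Q x
    go G ih (g , refl) = step R (All.tabulate λ m → let G′ , m′ , c = class-option R m in ih m′ c)
      where R = realisation-of g

  minimal-realisation : {B : Carrier → Set} → Decidable B → ∀ {x} → B x →
                        ∃₂ λ y S → B y × All (¬_ ∘ B) S × Realisation y S
  minimal-realisation {B} B? {x} Bx = let G , c = class-exists x in game-ind Minimal descend G c Bx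
    where
    Minimal : Game → Set
    Minimal G = ∀ {x} → G has-class x → B x → ∃₂ λ y S → B y × All (¬_ ∘ B) S × Realisation y S
    descend : ∀ G → (∀ {G′} → G′ ∈ options G → Minimal G′) → Minimal G
    descend G ih (g , refl) Bx with any? B? (optionClasses g)
    ... | yes found = let s , m , Bs = find found ; G′ , m′ , c = class-option (realisation-of g) m in ih m′ c Bs
    ... | no  none  = _ , _ , Bx , ¬Any⇒All¬ _ none , realisation-of g

  options-determine-class : ∀ {x y S} → Realisation x S → Realisation y S → x ≡ y
  options-determine-class {x} {y} {S} R R′ = reduced x y (class-ind _ step)
    where
    step : ∀ {w Sw} → Realisation w Sw → All (λ s → isPᶜ (x ∙ s) ≡ isPᶜ (y ∙ s)) Sw →
           isPᶜ (x ∙ w) ≡ isPᶜ (y ∙ w)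
    step {w} {Sw} Rw ih = begin
      isPᶜ (x ∙ w)                                     ≡⟨ isPᶜ-realisation (realisation-∙ R Rw) ⟩
      outcomeRule isPᶜ (map (_∙ w) S ++ map (x ∙_) Sw) ≡⟨ outcomeRule-++-map isPᶜ (map (_∙ w) S) ih ⟩
      outcomeRule isPᶜ (map (_∙ w) S ++ map (y ∙_) Sw) ≡⟨ isPᶜ-realisation (realisation-∙ R′ Rw) ⟨
      isPᶜ (y ∙ w)                                     ∎
      where open ≡-Reasoning

  realisation-square : ∀ {x} → Realisation x (ε ∷ []) → Realisation (x ∙ x) (x ∷ [])
  realisation-square {x} R = realisation-resp
    (λ { (here e) → here (trans e (identityˡ x)) ; (there (here e)) → here (trans e (identityʳ x)) })
    (λ { (here e) → here (trans e (sym (identityˡ x))) })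
    (realisation-∙ R R)

  -- The misère identity *1 + *1 = 0.
  ε-options⇒involutive : ∀ {x} → Realisation x (ε ∷ []) → x ∙ x ≡ ε
  ε-options⇒involutive {x} R = reduced (x ∙ x) ε λ w → trans (class-ind Q step w) (cong isPᶜ (sym (identityˡ w)))
    where
    Q : Carrier → Set
    Q w = isPᶜ ((x ∙ x) ∙ w) ≡ isPᶜ w
    none : List Carrier → Bool
    none = all (not ∘ isPᶜ)
    absorb : ∀ p q → not (not p ∧ q) ∧ p ≡ p
    absorb true  q = refl
    absorb false q = ∧-zeroʳ _
    collapse : ∀ S → not (not (outcomeRule isPᶜ S) ∧ none (map (x ∙_) S)) ∧ none S ≡ outcomeRule isPᶜ S
    collapse []      = refl
    collapse (s ∷ S) = absorb _ _
    step : ∀ {w Sw} → Realisation w Sw → All Q Sw → Q w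
    step {w} {Sw} Rw ih = begin
      isPᶜ ((x ∙ x) ∙ w)                            ≡⟨ isPᶜ-realisation (realisation-∙ (realisation-square R) Rw) ⟩
      outcomeRule isPᶜ ((x ∙ w) ∷ [] ++ map ((x ∙ x) ∙_) Sw)
                                                    ≡⟨ outcomeRule-++-map isPᶜ ((x ∙ w) ∷ []) ih ⟩
      outcomeRule isPᶜ ((x ∙ w) ∷ [] ++ map id Sw)  ≡⟨ cong (λ S → outcomeRule isPᶜ ((x ∙ w) ∷ S)) (map-id Sw) ⟩
      not (isPᶜ (x ∙ w)) ∧ none Sw                  ≡⟨ cong (λ p → not p ∧ none Sw) isPᶜ-x∙w ⟩
      not (not (outcomeRule isPᶜ Sw) ∧ none (map (x ∙_) Sw)) ∧ none Sw
                                                    ≡⟨ collapse Sw ⟩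
      outcomeRule isPᶜ Sw                           ≡⟨ isPᶜ-realisation Rw ⟨
      isPᶜ w                                        ∎
      where
      open ≡-Reasoning
      isPᶜ-x∙w : isPᶜ (x ∙ w) ≡ not (outcomeRule isPᶜ Sw) ∧ none (map (x ∙_) Sw)
      isPᶜ-x∙w = begin
        isPᶜ (x ∙ w)                                ≡⟨ isPᶜ-realisation (realisation-∙ R Rw) ⟩
        not (isPᶜ (ε ∙ w)) ∧ none (map (x ∙_) Sw)   ≡⟨ cong (λ v → not (isPᶜ v) ∧ none (map (x ∙_) Sw)) (identityˡ w) ⟩
        not (isPᶜ w) ∧ none (map (x ∙_) Sw)         ≡⟨ cong (λ p → not p ∧ none (map (x ∙_) Sw)) (isPᶜ-realisation Rw) ⟩
        not (outcomeRule isPᶜ Sw) ∧ none (map (x ∙_) Sw) ∎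

data Monomial : Set where
  a^_b^_c^_ : Bool → ℕ → ℕ → Monomial

infixl 7 _*ᵐ_
_*ᵐ_ : Monomial → Monomial → Monomial
(a^ j b^ i c^ k) *ᵐ (a^ j′ b^ i′ c^ k′) = a^ (j xor j′) b^ (i + i′) c^ (k + k′)

1ᵐ aᵐ bᵐ cᵐ : Monomial
1ᵐ = a^ false b^ 0 c^ 0
aᵐ = a^ true  b^ 0 c^ 0
bᵐ = a^ false b^ 1 c^ 0
cᵐ = a^ false b^ 0 c^ 1

bit : Bool → ℕ
bit false = 0
bit true  = 1

-- μ decreases strictly along moves and β does not increase (the options of c are c-free with b-degree ≤ 2),
-- so the outcomes of the monomials with β ≤ 6 are determined by induction on μ.
μ β : Monomial → ℕ
μ (a^ j b^ i c^ k) = bit j + (i * 2 + k * 6)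
β (a^ j b^ i c^ k) = i + k * 2

bit-xor : ∀ j j′ → bit (j xor j′) ≤ bit j + bit j′
bit-xor false j′    = ≤-refl
bit-xor true  false = ≤-refl
bit-xor true  true  = z≤n

μ-* : ∀ u v → μ (u *ᵐ v) ≤ μ u + μ v
μ-* (a^ j b^ i c^ k) (a^ j′ b^ i′ c^ k′) = begin
  bit (j xor j′) + ((i + i′) * 2 + (k + k′) * 6)             ≤⟨ +-monoˡ-≤ _ (bit-xor j j′) ⟩
  (bit j + bit j′) + ((i + i′) * 2 + (k + k′) * 6)           ≡⟨ rearrange (bit j) (bit j′) i i′ k k′ ⟩
  (bit j + (i * 2 + k * 6)) + (bit j′ + (i′ * 2 + k′ * 6))  ∎
  where
  open ≤-Reasoning
  rearrange = solve 6 (λ p q i i′ k k′ → (p :+ q) :+ ((i :+ i′) :* con 2 :+ (k :+ k′) :* con 6)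
                                       := (p :+ (i :* con 2 :+ k :* con 6)) :+ (q :+ (i′ :* con 2 :+ k′ :* con 6)))
                      refl

β-* : ∀ u v → β (u *ᵐ v) ≡ β u + β v
β-* (a^ j b^ i c^ k) (a^ j′ b^ i′ c^ k′) =
  solve 4 (λ i i′ k k′ → (i :+ i′) :+ (k :+ k′) :* con 2 := (i :+ k :* con 2) :+ (i′ :+ k′ :* con 2))
          refl i i′ k k′

sumOptions-μ : ∀ g h {O W} → All (λ o → μ o < μ g) O → All (λ w → μ w < μ h) W →
               All (λ v → μ v < μ g + μ h) (sumOptions _*ᵐ_ g h O W)
sumOptions-μ g h O< W< = All-++⁺
  (All-map⁺ (All.map (λ {o} o< → ≤-<-trans (μ-* o h) (+-monoˡ-< (μ h) o<)) O<))
  (All-map⁺ (All.map (λ {w} w< → ≤-<-trans (μ-* g w) (+-monoʳ-< (μ g) w<)) W<))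

sumOptions-β : ∀ g h {O W} → All (λ o → β o ≤ β g) O → All (λ w → β w ≤ β h) W →
               All (λ v → β v ≤ β g + β h) (sumOptions _*ᵐ_ g h O W)
sumOptions-β g h O≤ W≤ = All-++⁺
  (All-map⁺ (All.map (λ {o} o≤ → ≤-trans (≤-reflexive (β-* o h)) (+-monoˡ-≤ (β h) o≤)) O≤))
  (All-map⁺ (All.map (λ {w} w≤ → ≤-trans (≤-reflexive (β-* g w)) (+-monoʳ-≤ (β g) w≤)) W≤))

module Evaluation (M : BipartiteMonoid) (a b c : BipartiteMonoid.Carrier M)
                  (a∙a≡ε : BipartiteMonoid._∙_ M a a ≡ BipartiteMonoid.ε M) where
  open BipartiteMonoid M
  open CommutativeMonoid (commutativeMonoid M) using (monoid; commutativeSemigroup; identityʳ)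
  open import Algebra.Properties.Monoid.Mult monoid using (×-homo-+) renaming (_×_ to _times_)
  open import Algebra.Properties.CommutativeSemigroup commutativeSemigroup using (interchange)

  infixr 8 _^_
  _^_ : Carrier → ℕ → Carrier
  x ^ n = n times x

  aᵇ : Bool → Carrier
  aᵇ false = ε
  aᵇ true  = a

  ⟦_⟧ : Monomial → Carrier
  ⟦ a^ j b^ i c^ k ⟧ = aᵇ j ∙ (b ^ i ∙ c ^ k)

  aᵇ-xor : ∀ j j′ → aᵇ (j xor j′) ≡ aᵇ j ∙ aᵇ j′
  aᵇ-xor false j′    = sym (identityˡ (aᵇ j′))
  aᵇ-xor true  false = sym (identityʳ a)
  aᵇ-xor true  true  = sym a∙a≡ε

  ⟦⟧-hom : ∀ u v → ⟦ u *ᵐ v ⟧ ≡ ⟦ u ⟧ ∙ ⟦ v ⟧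
  ⟦⟧-hom (a^ j b^ i c^ k) (a^ j′ b^ i′ c^ k′) = begin
    aᵇ (j xor j′) ∙ (b ^ (i + i′) ∙ c ^ (k + k′))
      ≡⟨ cong₂ _∙_ (aᵇ-xor j j′) (cong₂ _∙_ (×-homo-+ b i i′) (×-homo-+ c k k′)) ⟩
    (aᵇ j ∙ aᵇ j′) ∙ ((b ^ i ∙ b ^ i′) ∙ (c ^ k ∙ c ^ k′))
      ≡⟨ cong (aᵇ j ∙ aᵇ j′ ∙_) (interchange _ _ _ _) ⟩
    (aᵇ j ∙ aᵇ j′) ∙ ((b ^ i ∙ c ^ k) ∙ (b ^ i′ ∙ c ^ k′))
      ≡⟨ interchange _ _ _ _ ⟩
    (aᵇ j ∙ (b ^ i ∙ c ^ k)) ∙ (aᵇ j′ ∙ (b ^ i′ ∙ c ^ k′))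
      ∎
    where open ≡-Reasoning

  ⟦1ᵐ⟧ : ⟦ 1ᵐ ⟧ ≡ ε
  ⟦1ᵐ⟧ = trans (identityˡ _) (identityˡ ε)

  ⟦aᵐ⟧ : ⟦ aᵐ ⟧ ≡ a
  ⟦aᵐ⟧ = trans (cong (a ∙_) (identityˡ ε)) (identityʳ a)

  ⟦bᵐ⟧ : ⟦ bᵐ ⟧ ≡ b
  ⟦bᵐ⟧ = trans (identityˡ _) (trans (identityʳ _) (identityʳ b))

  ⟦cᵐ⟧ : ⟦ cᵐ ⟧ ≡ c
  ⟦cᵐ⟧ = trans (identityˡ _) (trans (identityˡ _) (identityʳ c))

basis : Bool → R8 → Monomial
basis s one = a^ false b^ 0 c^ 0
basis s a   = a^ true  b^ 0 c^ 0
basis s z₂  = a^ false b^ 1 c^ 0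
basis s z₃  = a^ true  b^ 1 c^ 0
basis s z₀  = a^ false b^ 2 c^ 0
basis s z₁  = a^ true  b^ 2 c^ 0
basis s t   = a^ s     b^ 0 c^ 1
basis s at  = a^ not s b^ 0 c^ 1

nonC cElements : List R8
nonC      = one ∷ a ∷ z₂ ∷ z₃ ∷ z₀ ∷ z₁ ∷ []
cElements = t ∷ at ∷ []

nonC-small : All (λ x → μ (basis false x) < 6 × β (basis false x) ≤ 2) nonC
nonC-small = toWitness {a? = all? (λ x → (suc (μ (basis false x)) ≤? 6) ×-dec (β (basis false x) ≤? 2)) nonC} tt

basis-nonC : ∀ s {y} → y ∈ nonC → basis s y ≡ basis false y
basis-nonC s (here refl)                                         = refl
basis-nonC s (there (here refl))                                 = refl
basis-nonC s (there (there (here refl)))                         = refl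
basis-nonC s (there (there (there (here refl))))                 = refl
basis-nonC s (there (there (there (there (here refl)))))         = refl
basis-nonC s (there (there (there (there (there (here refl)))))) = refl

a-shift-nonC : ∀ {y} → y ∈ nonC → aᵐ *ᵐ basis false y ≡ basis false (a · y) × a · y ∈ nonC
a-shift-nonC (here refl)                                         = refl , there (here refl)
a-shift-nonC (there (here refl))                                 = refl , here refl
a-shift-nonC (there (there (here refl)))                         = refl , there (there (there (here refl)))
a-shift-nonC (there (there (there (here refl))))                 = refl , there (there (here refl))
a-shift-nonC (there (there (there (there (here refl)))))         = refl , there (there (there (there (there (here refl)))))
a-shift-nonC (there (there (there (there (there (here refl)))))) = refl , there (there (there (there (here refl))))

∈-bools : ∀ s → s ∈ false ∷ true ∷ []
∈-bools false = here refl
∈-bools true  = there (here refl)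

sublists : {X : Set} → List X → List (List X)
sublists []       = [] ∷ []
sublists (x ∷ xs) = map (x ∷_) (sublists xs) ++ sublists xs

filter∈sublists : {X : Set} {P : X → Set} (P? : Decidable P) (xs : List X) → filter P? xs ∈ sublists xs
filter∈sublists P? []       = here refl
filter∈sublists P? (x ∷ xs) with does (P? x)
... | true  = ∈-++⁺ˡ (∈-map⁺ (x ∷_) (filter∈sublists P? xs))
... | false = ∈-++⁺ʳ (map (x ∷_) (sublists xs)) (filter∈sublists P? xs)

-- Outcome tables for the possible option sets of c

-- Entry i of row k holds the outcomes of bⁱcᵏ and abⁱcᵏ; entries outside the table read as false.
Row Table : Set
Row   = List (Bool × Bool)
Table = List Row

entryOr : {X : Set} → X → List X → ℕ → X
entryOr d []       n       = d
entryOr d (x ∷ xs) zero    = x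
entryOr d (x ∷ xs) (suc n) = entryOr d xs n

read : Table → Monomial → Bool
read T (a^ j b^ i c^ k) = Bool.if j then proj₂ entry else proj₁ entry
  where entry = entryOr (false , false) (entryOr [] T k) i

-- σ ⊆ nonC lists the c-free products basis x that are options of c.
module Outcomes (σ : List R8) where
  τ : List Monomial
  τ = map (basis false) σ

  movesᶠ : ℕ → ℕ → List Monomial
  movesᶠ (suc i) k       = sumOptions _*ᵐ_ bᵐ (a^ false b^ i c^ k) (1ᵐ ∷ aᵐ ∷ []) (movesᶠ i k)
  movesᶠ zero    (suc k) = sumOptions _*ᵐ_ cᵐ (a^ false b^ 0 c^ k) τ (movesᶠ 0 k)
  movesᶠ zero    zero    = []

  moves : Monomial → List Monomial
  moves (a^ false b^ i c^ k) = movesᶠ i k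
  moves (a^ true  b^ i c^ k) = sumOptions _*ᵐ_ aᵐ (a^ false b^ i c^ k) (1ᵐ ∷ []) (movesᶠ i k)

  module _ (σ⊆nonC : σ ⊆ nonC) where
    τ-μ : All (λ t → μ t < μ cᵐ) τ
    τ-μ = All-map⁺ (All.tabulate λ m → proj₁ (All.lookup nonC-small (σ⊆nonC m)))

    τ-β : All (λ t → β t ≤ β cᵐ) τ
    τ-β = All-map⁺ (All.tabulate λ m → proj₂ (All.lookup nonC-small (σ⊆nonC m)))

    movesᶠ-μ : ∀ i k → All (λ v → μ v < μ (a^ false b^ i c^ k)) (movesᶠ i k)
    movesᶠ-μ (suc i) k       = sumOptions-μ bᵐ (a^ false b^ i c^ k) (s≤s z≤n ∷ s≤s (s≤s z≤n) ∷ [])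
                                             (movesᶠ-μ i k)
    movesᶠ-μ zero    (suc k) = sumOptions-μ cᵐ (a^ false b^ 0 c^ k) τ-μ (movesᶠ-μ 0 k)
    movesᶠ-μ zero    zero    = []

    moves-μ : ∀ u → All (λ v → μ v < μ u) (moves u)
    moves-μ (a^ false b^ i c^ k) = movesᶠ-μ i k
    moves-μ (a^ true  b^ i c^ k) = sumOptions-μ aᵐ (a^ false b^ i c^ k) (s≤s z≤n ∷ []) (movesᶠ-μ i k)

    movesᶠ-β : ∀ i k → All (λ v → β v ≤ β (a^ false b^ i c^ k)) (movesᶠ i k)
    movesᶠ-β (suc i) k       = sumOptions-β bᵐ (a^ false b^ i c^ k) {1ᵐ ∷ aᵐ ∷ []} (z≤n ∷ z≤n ∷ [])
                                             (movesᶠ-β i k)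
    movesᶠ-β zero    (suc k) = sumOptions-β cᵐ (a^ false b^ 0 c^ k) τ-β (movesᶠ-β 0 k)
    movesᶠ-β zero    zero    = []

    moves-β : ∀ u → All (λ v → β v ≤ β u) (moves u)
    moves-β (a^ false b^ i c^ k) = movesᶠ-β i k
    moves-β (a^ true  b^ i c^ k) = sumOptions-β aᵐ (a^ false b^ i c^ k) {1ᵐ ∷ []} (z≤n ∷ []) (movesᶠ-β i k)

  -- The moves of bⁱcᵏ only reach earlier rows and entries; those of abⁱcᵏ also reach bⁱcᵏ itself.
  nextEntry : Table → Row → Bool × Bool
  nextEntry T r = o , o′
    where
    o  = outcomeRule (read (T ++ r ∷ [])) (moves (a^ false b^ length r c^ length T))
    o′ = outcomeRule (read (T ++ (r ++ (o , false) ∷ []) ∷ [])) (moves (a^ true b^ length r c^ length T))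

  fillRow : Table → ℕ → Row → Row
  fillRow T zero    r = r
  fillRow T (suc n) r = fillRow T n (r ++ nextEntry T r ∷ [])

  fillTable : ℕ → Table → Table
  fillTable zero    T = T
  fillTable (suc n) T = fillTable n (T ++ fillRow T 7 [] ∷ [])

  table : Table
  table = fillTable 4 []

  InBox : Monomial → Set
  InBox u = β u ≤ 6

  b-bound : ∀ i k → i + k * 2 ≤ 6 → i < 7
  b-bound i k inBox = s≤s (≤-trans (m≤m+n i (k * 2)) inBox)
  c-bound : ∀ i k → i + k * 2 ≤ 6 → k < 7
  c-bound i k inBox = s≤s (≤-trans (m≤m*n k 2) (≤-trans (m≤n+m (k * 2) i) inBox))

  RuleAt : (Monomial → Bool) → Monomial → Set
  RuleAt f u = InBox u → f u ≡ outcomeRule f (moves u)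

  Consistent : (Monomial → Bool) → Set
  Consistent f = ∀ {k} → k < 7 → ∀ {i} → i < 7 → RuleAt f (a^ false b^ i c^ k) × RuleAt f (a^ true b^ i c^ k)

  consistent⇒rule : ∀ {f} → Consistent f → ∀ u → InBox u → f u ≡ outcomeRule f (moves u)
  consistent⇒rule consistent (a^ false b^ i c^ k) inBox = proj₁ (consistent (c-bound i k inBox) (b-bound i k inBox)) inBox
  consistent⇒rule consistent (a^ true  b^ i c^ k) inBox = proj₂ (consistent (c-bound i k inBox) (b-bound i k inBox)) inBox

  AgreeAt DifferAt : (Monomial → Bool) → Monomial → Monomial → R8 → Set
  AgreeAt  f u v w = let u′ = u *ᵐ basis false w ; v′ = v *ᵐ basis false w in InBox u′ × InBox v′ × f u′ ≡ f v′
  DifferAt f u v w = let u′ = u *ᵐ basis false w ; v′ = v *ᵐ basis false w in InBox u′ × InBox v′ × f u′ ≢ f v′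

  Agree Differ : (Monomial → Bool) → Monomial → Monomial → Set
  Agree  f u v = All (AgreeAt f u v) elements
  Differ f u v = Any (DifferAt f u v) elements

  -- c and ac are told apart from the c-free products by the choice of c rather than by the table.
  Separated : (Monomial → Bool) → Bool → R8 → R8 → Set
  Separated f s x y = x ≡ y ⊎ (x ∈ cElements × y ∈ nonC) ⊎ (y ∈ cElements × x ∈ nonC)
                      ⊎ Differ f (basis s x) (basis s y)

  Distinct : (Monomial → Bool) → Set
  Distinct f = All (λ s → All (λ x → All (Separated f s x) elements) elements) (false ∷ true ∷ [])

  Model : (Monomial → Bool) → Bool → Set
  Model f s = All (λ x → All (λ y → Agree f (basis s x *ᵐ basis s y) (basis s (x · y))) elements) elements
            × All (λ x → InBox (basis s x) × f (basis s x) ≡ isPᴿ x) elements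

  Verdict : (Monomial → Bool) → Set
  Verdict f = Any (λ y → Agree f cᵐ (basis false y)) nonC
            ⊎ Any (λ u → All (Differ f u ∘ basis false) elements) (bᵐ *ᵐ bᵐ *ᵐ bᵐ ∷ bᵐ *ᵐ cᵐ ∷ [])
            ⊎ Any (Model f) (false ∷ true ∷ [])

  Certified : (Monomial → Bool) → Set
  Certified f = Consistent f × Distinct f × Verdict f

  certified? : ∀ f → Dec (Certified f)
  certified? f = consistent? ×-dec distinct? ×-dec verdict?
    where
    inBox? : ∀ u → Dec (InBox u)
    inBox? u = β u ≤? 6
    ruleAt? : ∀ u → Dec (RuleAt f u)
    ruleAt? u = inBox? u →-dec (f u Bool.≟ outcomeRule f (moves u))
    consistent? : Dec (Consistent f)
    consistent? = allUpTo? (λ k → allUpTo? (λ i → ruleAt? (a^ false b^ i c^ k) ×-dec ruleAt? (a^ true b^ i c^ k))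
                                          7) 7
    agree? : ∀ u v → Dec (Agree f u v)
    agree? u v = all? (λ w → let u′ = u *ᵐ basis false w ; v′ = v *ᵐ basis false w in
                              inBox? u′ ×-dec inBox? v′ ×-dec (f u′ Bool.≟ f v′)) elements
    differ? : ∀ u v → Dec (Differ f u v)
    differ? u v = any? (λ w → let u′ = u *ᵐ basis false w ; v′ = v *ᵐ basis false w in
                               inBox? u′ ×-dec inBox? v′ ×-dec ¬? (f u′ Bool.≟ f v′)) elements
    separated? : ∀ s x y → Dec (Separated f s x y)
    separated? s x y = (x ≟ᴿ y) ⊎-dec (x ∈ᴿ? cElements ×-dec y ∈ᴿ? nonC) ⊎-dec (y ∈ᴿ? cElements ×-dec x ∈ᴿ? nonC)
                       ⊎-dec differ? (basis s x) (basis s y)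
    distinct? : Dec (Distinct f)
    distinct? = all? (λ s → all? (λ x → all? (separated? s x) elements) elements) (false ∷ true ∷ [])
    model? : ∀ s → Dec (Model f s)
    model? s = all? (λ x → all? (λ y → agree? (basis s x *ᵐ basis s y) (basis s (x · y))) elements) elements
               ×-dec all? (λ x → inBox? (basis s x) ×-dec (f (basis s x) Bool.≟ isPᴿ x)) elements
    verdict? : Dec (Verdict f)
    verdict? = any? (λ y → agree? cᵐ (basis false y)) nonC
               ⊎-dec any? (λ u → all? (differ? u ∘ basis false) elements) (bᵐ *ᵐ bᵐ *ᵐ bᵐ ∷ bᵐ *ᵐ cᵐ ∷ [])
               ⊎-dec any? model? (false ∷ true ∷ [])

all-certified : All (λ σ → Outcomes.Certified σ (read (Outcomes.table σ))) (sublists nonC)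
all-certified = toWitness {a? = all? (λ σ → Outcomes.certified? σ (read (Outcomes.table σ))) (sublists nonC)} tt

-- Quotients of order 8

module Classification {A : Game → Set} {M : BipartiteMonoid} (closed : Closed A) (presents : Presents A M)
                      (M↔Fin8 : BipartiteMonoid.Carrier M ↔ Fin 8) where
  open BipartiteMonoid M
  open Presentation closed presents
  open Finite M↔Fin8 using (_∈?_; ∃-∉; injective⇒surjective)

  realisation-select : {I : Set} (g : I → Carrier) (L : List I) → ∀ {x S} → S ⊆ map g L →
                       Realisation x S → Realisation x (map g (filter (λ i → g i ∈? S) L))
  realisation-select g L {S = S} S⊆ R = realisation-resp into-selection out-of-selection R
    where
    into-selection : S ⊆ map g (filter (λ i → g i ∈? S) L)
    into-selection m with ∈-map⁻ g (S⊆ m)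
    ... | i , mi , refl = ∈-map⁺ g (∈-filter⁺ (λ i → g i ∈? S) mi m)
    out-of-selection : map g (filter (λ i → g i ∈? S) L) ⊆ S
    out-of-selection m with ∈-map⁻ g m
    ... | i , mi , refl = proj₂ (∈-filter⁻ (λ i → g i ∈? S) {xs = L} mi)

  realisation-filter : (L : List Carrier) → ∀ {x S} → S ⊆ L → Realisation x S → Realisation x (filter (_∈? S) L)
  realisation-filter L {x} S⊆ R = subst (Realisation x) (map-id _) (realisation-select id L (∈-map⁺ id ∘ S⊆) R)

  fresh-minimal : (L : List Carrier) → length L < 8 → ∃₂ λ x S → x ∉ L × S ⊆ L × Realisation x S
  fresh-minimal L short =
    let y , y∉L = ∃-∉ L short
        x , S , x∉L , S∈L , R = minimal-realisation (λ v → ¬? (v ∈? L)) y∉L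
    in x , S , x∉L , (λ m → decidable-stable (_ ∈? L) (All.lookup S∈L m)) , R

  star₁ : ∃ λ aₘ → Realisation aₘ (ε ∷ [])
  star₁ with fresh-minimal (ε ∷ []) (s≤s (s≤s z≤n))
  ... | x , S , x∉ , S⊆ , R with ε ∈? S
  ... | yes ε∈S = x , subst (Realisation x) (filter-accept (_∈? S) ε∈S) (realisation-filter (ε ∷ []) S⊆ R)
  ... | no  ε∉S = contradiction (here (options-determine-class R′ realisation-𝟎)) x∉
    where R′ = subst (Realisation x) (filter-reject (_∈? S) ε∉S) (realisation-filter (ε ∷ []) S⊆ R)

  star₂ : ∀ {aₘ} → Realisation aₘ (ε ∷ []) → ∃ λ bₘ → Realisation bₘ (ε ∷ aₘ ∷ [])
  star₂ {aₘ} Ra with fresh-minimal (ε ∷ aₘ ∷ []) (s≤s (s≤s (s≤s z≤n)))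
  ... | x , S , x∉ , S⊆ , R with ε ∈? S | aₘ ∈? S
  ... | yes ε∈S | yes a∈S = x , subst (Realisation x)
          (trans (filter-accept (_∈? S) ε∈S) (cong (ε ∷_) (filter-accept (_∈? S) a∈S)))
          (realisation-filter (ε ∷ aₘ ∷ []) S⊆ R)
  ... | yes ε∈S | no  a∉S = contradiction (there (here (options-determine-class R′ Ra))) x∉
    where R′ = subst (Realisation x) (trans (filter-accept (_∈? S) ε∈S) (cong (ε ∷_) (filter-reject (_∈? S) a∉S)))
                     (realisation-filter (ε ∷ aₘ ∷ []) S⊆ R)
  ... | no  ε∉S | yes a∈S =
    contradiction (here (trans (options-determine-class R′ (realisation-square Ra)) (ε-options⇒involutive Ra))) x∉
    where R′ = subst (Realisation x) (trans (filter-reject (_∈? S) ε∉S) (filter-accept (_∈? S) a∈S))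
                     (realisation-filter (ε ∷ aₘ ∷ []) S⊆ R)
  ... | no  ε∉S | no  a∉S = contradiction (here (options-determine-class R′ realisation-𝟎)) x∉
    where R′ = subst (Realisation x) (trans (filter-reject (_∈? S) ε∉S) (filter-reject (_∈? S) a∉S))
                     (realisation-filter (ε ∷ aₘ ∷ []) S⊆ R)

  -- The six products aʲbⁱ (i ≤ 2) do not involve c; they are evaluated with ε for c before c is chosen.
  record Generators : Set where
    field
      aₘ bₘ cₘ  : Carrier
      a∙a≡ε     : aₘ ∙ aₘ ≡ ε
      realise-a : Realisation aₘ (ε ∷ [])
      realise-b : Realisation bₘ (ε ∷ aₘ ∷ [])
      σ         : List R8
      σ-sublist : σ ∈ sublists nonC
      σ⊆nonC    : σ ⊆ nonC
      realise-c : Realisation cₘ (map (Evaluation.⟦_⟧ M aₘ bₘ ε a∙a≡ε ∘ basis false) σ)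
      c-fresh   : cₘ ∉ map (Evaluation.⟦_⟧ M aₘ bₘ ε a∙a≡ε ∘ basis false) nonC

  generators : Generators
  generators =
    let aₘ , Ra = star₁
        a∙a≡ε = ε-options⇒involutive Ra
        bₘ , Rb = star₂ Ra
        sixth = Evaluation.⟦_⟧ M aₘ bₘ ε a∙a≡ε ∘ basis false
        cₘ , S , c∉ , S⊆ , Rc = fresh-minimal (map sixth nonC) (s≤s (s≤s (s≤s (s≤s (s≤s (s≤s (s≤s z≤n)))))))
        option? = λ x → sixth x ∈? S
    in record
      { aₘ = aₘ ; bₘ = bₘ ; cₘ = cₘ ; a∙a≡ε = a∙a≡ε ; realise-a = Ra ; realise-b = Rb
      ; σ = filter option? nonC ; σ-sublist = filter∈sublists option? nonC ; σ⊆nonC = proj₁ ∘ ∈-filter⁻ option?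
      ; realise-c = realisation-select sixth nonC S⊆ Rc ; c-fresh = c∉
      }

  module FromGenerators (generators : Generators) where
    open Generators generators
    open Outcomes σ
    open Evaluation M aₘ bₘ cₘ a∙a≡ε
    private module E₀ = Evaluation M aₘ bₘ ε a∙a≡ε

    realisation-* : ∀ u v {L L′} → Realisation ⟦ u ⟧ (map ⟦_⟧ L) → Realisation ⟦ v ⟧ (map ⟦_⟧ L′) →
                    Realisation ⟦ u *ᵐ v ⟧ (map ⟦_⟧ (sumOptions _*ᵐ_ u v L L′))
    realisation-* u v {L} {L′} R R′ = subst₂ Realisation (sym (⟦⟧-hom u v)) options-eq (realisation-∙ R R′)
      where
      map-⟦⟧ : (f : Carrier → Carrier) (g : Monomial → Monomial) → (∀ w → f ⟦ w ⟧ ≡ ⟦ g w ⟧) →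
               ∀ L → map f (map ⟦_⟧ L) ≡ map ⟦_⟧ (map g L)
      map-⟦⟧ f g f∘⟦⟧≗⟦⟧∘g L = trans (sym (map-∘ L)) (trans (map-cong f∘⟦⟧≗⟦⟧∘g L) (map-∘ L))
      options-eq : sumOptions _∙_ ⟦ u ⟧ ⟦ v ⟧ (map ⟦_⟧ L) (map ⟦_⟧ L′) ≡ map ⟦_⟧ (sumOptions _*ᵐ_ u v L L′)
      options-eq = trans (cong₂ _++_ (map-⟦⟧ (_∙ ⟦ v ⟧) (_*ᵐ v) (λ w → sym (⟦⟧-hom w v)) L)
                                      (map-⟦⟧ (⟦ u ⟧ ∙_) (u *ᵐ_) (λ w → sym (⟦⟧-hom u w)) L′))
                         (sym (map-++ ⟦_⟧ (map (_*ᵐ v) L) (map (u *ᵐ_) L′)))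

    ⟦basis⟧-c-free : All (λ x → E₀.⟦ basis false x ⟧ ≡ ⟦ basis false x ⟧) nonC
    ⟦basis⟧-c-free = refl ∷ refl ∷ refl ∷ refl ∷ refl ∷ refl ∷ []

    realisation-aᵐ : Realisation ⟦ aᵐ ⟧ (map ⟦_⟧ (1ᵐ ∷ []))
    realisation-aᵐ = subst₂ Realisation (sym ⟦aᵐ⟧) (cong (_∷ []) (sym ⟦1ᵐ⟧)) realise-a

    realisation-bᵐ : Realisation ⟦ bᵐ ⟧ (map ⟦_⟧ (1ᵐ ∷ aᵐ ∷ []))
    realisation-bᵐ = subst₂ Realisation (sym ⟦bᵐ⟧) (cong₂ (λ x y → x ∷ y ∷ []) (sym ⟦1ᵐ⟧) (sym ⟦aᵐ⟧))
                            realise-b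

    realisation-cᵐ : Realisation ⟦ cᵐ ⟧ (map ⟦_⟧ τ)
    realisation-cᵐ = subst₂ Realisation (sym ⟦cᵐ⟧)
      (trans (map-cong-local (All.tabulate (All.lookup ⟦basis⟧-c-free ∘ σ⊆nonC))) (map-∘ σ)) realise-c

    realisationᶠ : ∀ i k → Realisation ⟦ a^ false b^ i c^ k ⟧ (map ⟦_⟧ (movesᶠ i k))
    realisationᶠ (suc i) k       = realisation-* bᵐ (a^ false b^ i c^ k) {1ᵐ ∷ aᵐ ∷ []} realisation-bᵐ
                                                   (realisationᶠ i k)
    realisationᶠ zero    (suc k) = realisation-* cᵐ (a^ false b^ 0 c^ k) {τ} realisation-cᵐ (realisationᶠ zero k)
    realisationᶠ zero    zero    = subst (λ x → Realisation x []) (sym ⟦1ᵐ⟧) realisation-𝟎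

    realisation-monomial : ∀ u → Realisation ⟦ u ⟧ (map ⟦_⟧ (moves u))
    realisation-monomial (a^ false b^ i c^ k) = realisationᶠ i k
    realisation-monomial (a^ true  b^ i c^ k) = realisation-* aᵐ (a^ false b^ i c^ k) {1ᵐ ∷ []} realisation-aᵐ
                                                                (realisationᶠ i k)

    certificate-sound : ∀ {f} → Consistent f → ∀ u → InBox u → isPᶜ ⟦ u ⟧ ≡ f u
    certificate-sound {f} consistent = WF.All.wfRec (On.wellFounded μ <-wellFounded) 0ℓ
                                         (λ u → InBox u → isPᶜ ⟦ u ⟧ ≡ f u) step
      where
      step : ∀ u → (∀ {v} → μ v < μ u → InBox v → isPᶜ ⟦ v ⟧ ≡ f v) → InBox u → isPᶜ ⟦ u ⟧ ≡ f u
      step u ih inBox = begin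
        isPᶜ ⟦ u ⟧                           ≡⟨ isPᶜ-realisation (realisation-monomial u) ⟩
        outcomeRule isPᶜ (map ⟦_⟧ (moves u)) ≡⟨ outcomeRule-map isPᶜ ⟦_⟧ (moves u) ⟩
        outcomeRule (isPᶜ ∘ ⟦_⟧) (moves u)   ≡⟨ outcomeRule-pointwise (All.zipWith
                                                   (λ (v<u , v≤u) → ih v<u (≤-trans v≤u inBox))
                                                   (moves-μ σ⊆nonC u , moves-β σ⊆nonC u)) ⟩
        outcomeRule f (moves u)               ≡⟨ consistent⇒rule consistent u inBox ⟨
        f u                                   ∎
        where open ≡-Reasoning

    f : Monomial → Bool
    f = read table

    certified : Certified f
    certified = All.lookup all-certified σ-sublist

    sound : ∀ u → InBox u → isPᶜ ⟦ u ⟧ ≡ f u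
    sound = certificate-sound (proj₁ certified)

    isPᶜ-∙basis : ∀ u w → InBox (u *ᵐ basis false w) →
                  isPᶜ (⟦ u ⟧ ∙ ⟦ basis false w ⟧) ≡ f (u *ᵐ basis false w)
    isPᶜ-∙basis u w inBox = trans (cong isPᶜ (sym (⟦⟧-hom u (basis false w)))) (sound (u *ᵐ basis false w) inBox)

    differ⇒≢ : ∀ u v → Differ f u v → ⟦ u ⟧ ≢ ⟦ v ⟧
    differ⇒≢ u v differ ⟦u⟧≡⟦v⟧ =
      let w , inU , inV , f≢ = Any.satisfied differ in
      f≢ (trans (sym (isPᶜ-∙basis u w inU))
                (trans (cong (λ x → isPᶜ (x ∙ ⟦ basis false w ⟧)) ⟦u⟧≡⟦v⟧) (isPᶜ-∙basis v w inV)))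

    nonC-not-c : ∀ {y} → y ∈ nonC → ⟦ basis false y ⟧ ≢ cₘ
    nonC-not-c m e = c-fresh (subst (_∈ map sixth nonC) (trans (All.lookup ⟦basis⟧-c-free m) e) (∈-map⁺ sixth m))
      where sixth = E₀.⟦_⟧ ∘ basis false

    c-monomial-fresh : ∀ j {y} → y ∈ nonC → ⟦ a^ j b^ 0 c^ 1 ⟧ ≢ ⟦ basis false y ⟧
    c-monomial-fresh false m e = nonC-not-c m (trans (sym e) ⟦cᵐ⟧)
    c-monomial-fresh true {y} m e = nonC-not-c (proj₂ (a-shift-nonC m)) (begin
      ⟦ basis false (a · y) ⟧          ≡⟨ cong ⟦_⟧ (proj₁ (a-shift-nonC m)) ⟨
      ⟦ aᵐ *ᵐ basis false y ⟧          ≡⟨ ⟦⟧-hom aᵐ (basis false y) ⟩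
      ⟦ aᵐ ⟧ ∙ ⟦ basis false y ⟧       ≡⟨ cong (⟦ aᵐ ⟧ ∙_) e ⟨
      ⟦ aᵐ ⟧ ∙ ⟦ a^ true b^ 0 c^ 1 ⟧   ≡⟨ ⟦⟧-hom aᵐ (a^ true b^ 0 c^ 1) ⟨
      ⟦ cᵐ ⟧                           ≡⟨ ⟦cᵐ⟧ ⟩
      cₘ                               ∎)
      where open ≡-Reasoning

    c-not-nonC : ∀ s {x y} → x ∈ cElements → y ∈ nonC → ⟦ basis s x ⟧ ≢ ⟦ basis s y ⟧
    c-not-nonC s (here refl)         m e = c-monomial-fresh s       m (trans e (cong ⟦_⟧ (basis-nonC s m)))
    c-not-nonC s (there (here refl)) m e = c-monomial-fresh (not s) m (trans e (cong ⟦_⟧ (basis-nonC s m)))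

    basis-injective : ∀ s → Injective _≡_ _≡_ (⟦_⟧ ∘ basis s)
    basis-injective s {x} {y} e = distinguish
      (All.lookup (All.lookup (All.lookup (proj₁ (proj₂ certified)) (∈-bools s)) (∈-elements x)) (∈-elements y))
      where
      distinguish : Separated f s x y → x ≡ y
      distinguish (inj₁ x≡y)                          = x≡y
      distinguish (inj₂ (inj₁ (x∈c , y∈nonC)))        = contradiction e (c-not-nonC s x∈c y∈nonC)
      distinguish (inj₂ (inj₂ (inj₁ (y∈c , x∈nonC)))) = contradiction (sym e) (c-not-nonC s y∈c x∈nonC)
      distinguish (inj₂ (inj₂ (inj₂ differ)))         = contradiction e (differ⇒≢ (basis s x) (basis s y) differ)

    basis-surjective : ∀ s m → ∃ λ x → ⟦ basis s x ⟧ ≡ m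
    basis-surjective s = injective⇒surjective R8↔Fin8 (⟦_⟧ ∘ basis s) (basis-injective s)

    agree⇒≡ : ∀ u v → Agree f u v → ⟦ u ⟧ ≡ ⟦ v ⟧
    agree⇒≡ u v agree = reduced ⟦ u ⟧ ⟦ v ⟧ λ m → test m (basis-surjective false m)
      where
      test : ∀ m → ∃ (λ w → ⟦ basis false w ⟧ ≡ m) → isPᶜ (⟦ u ⟧ ∙ m) ≡ isPᶜ (⟦ v ⟧ ∙ m)
      test _ (w , refl) = let inU , inV , same = All.lookup agree (∈-elements w) in
        trans (isPᶜ-∙basis u w inU) (trans same (sym (isPᶜ-∙basis v w inV)))

    model⇒iso : ∀ {s} → Model f s → Iso M ℛ₈
    model⇒iso {s} (product , outcomes) =
      bijective-hom⇒Iso M ℛ₈ (⟦_⟧ ∘ basis s) (basis-injective s) (basis-surjective s) hom ⟦1ᵐ⟧ preserves-P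
      where
      hom : ∀ x y → ⟦ basis s (x · y) ⟧ ≡ ⟦ basis s x ⟧ ∙ ⟦ basis s y ⟧
      hom x y = trans (sym (agree⇒≡ (basis s x *ᵐ basis s y) (basis s (x · y))
                                    (All.lookup (All.lookup product (∈-elements x)) (∈-elements y))))
                      (⟦⟧-hom (basis s x) (basis s y))
      preserves-P : ∀ x → R8-P x ⇔ P ⟦ basis s x ⟧
      preserves-P x = let inBox , f≡isPᴿ = All.lookup outcomes (∈-elements x) in
        ⇔-trans (R8-P⇔isPᴿ x) (subst (λ p → T p ⇔ P ⟦ basis s x ⟧) (trans (sound (basis s x) inBox) f≡isPᴿ)
                                      (⇔-sym (P⇔isPᶜ ⟦ basis s x ⟧)))

    resolve : Verdict f → Iso M ℛ₈
    resolve (inj₁ c-agrees) = let y , m , agree = find c-agrees in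
      ⊥-elim (nonC-not-c m (trans (sym (agree⇒≡ cᵐ (basis false y) agree)) ⟦cᵐ⟧))
    resolve (inj₂ (inj₁ unrepresented)) =
      let u , _ , differs = find unrepresented ; w , e = basis-surjective false ⟦ u ⟧ in
      ⊥-elim (differ⇒≢ u (basis false w) (All.lookup differs (∈-elements w)) (sym e))
    resolve (inj₂ (inj₂ model)) = model⇒iso (proj₂ (Any.satisfied model))

    iso : Iso M ℛ₈
    iso = resolve (proj₂ (proj₂ certified))

theorem6p1 : IsMisereQuotient ℛ₈
    × ((M : BipartiteMonoid) → IsMisereQuotient M →
    (BipartiteMonoid.Carrier M ↔ Fin 8) → Iso M ℛ₈)
theorem6p1 = R8-isMisereQuotient , λ M (A , closed , presents) M↔Fin8 →
  Classification.FromGenerators.iso closed presents M↔Fin8 (Classification.generators closed presents M↔Fin8)
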